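{- Let $i,b\in\mathbb{Z}_{\ge1}$ with $3\le b\le 2i+7$. Then \[P_{2,(i,b)}:=\mathrm{conv}\left(\left(0,\tfrac32\right),(0,1),(2i+7-b,0),(2i+4,0),\left(2i+2,\tfrac12\right)\right)\subseteq\mathbb{R}^2\] is a pseudo-integral polygon with denominator $2$, exactly $i$ interior lattice points and exactly $b$ boundary lattice points.
   Context: The denominator of a rational polygon $P$ is the smallest positive integer $d$ such that $dP$ has all vertices in $\mathbb{Z}^2$. $P$ is pseudo-integral if its Ehrhart quasi-polynomial ($L_P(k)=|kP\cap\mathbb{Z}^2|$ for positive integers $k$) is a polynomial. -}

module Defs where

open import Data.Nat as ℕ using (ℕ; zero; suc)
open import Data.Integer as ℤ using (ℤ; +_)
open import Data.Rational using (ℚ; _/_; 0ℚ; 1ℚ; _+_; _*_; _-_; _≤_; _<_; ∣_∣)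
open import Data.Fin using (Fin) renaming (zero to fz; suc to fs)
open import Data.List using (List; []; _∷_)
open import Data.Product using (Σ; ∃; _×_; _,_; proj₁; proj₂)
open import Relation.Binary.PropositionalEquality using (_≡_)
open import Relation.Nullary using (¬_)

Pt : Set
Pt = ℚ × ℚ

ℤ→ℚ : ℤ → ℚ
ℤ→ℚ z = z / 1

ℕ→ℚ : ℕ → ℚ
ℕ→ℚ n = (+ n) / 1

ℤ²→Pt : ℤ × ℤ → Pt
ℤ²→Pt (a , b) = (ℤ→ℚ a , ℤ→ℚ b)

IsLatticePt : Pt → Set
IsLatticePt (x , y) = Σ (ℤ × ℤ) λ z → ℤ²→Pt z ≡ (x , y)

_·_ : ℚ → Pt → Pt
t · (x , y) = (t * x , t * y)

∑ : (n : ℕ) → (Fin n → ℚ) → ℚ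
∑ zero    f = 0ℚ
∑ (suc n) f = f fz + ∑ n (λ j → f (fs j))

-- A rational polygon given by a finite list of generating points (Fin n → Pt);
-- the polygon is their convex hull.
record Gens : Set where
  constructor gens
  field
    size : ℕ
    pts  : Fin size → Pt
open Gens public

_∈conv_ : Pt → Gens → Set
(x , y) ∈conv (gens n v) =
  Σ (Fin n → ℚ) λ c →
    ((j : Fin n) → 0ℚ ≤ c j)
    × ∑ n c ≡ 1ℚ
    × ∑ n (λ j → c j * proj₁ (v j)) ≡ x
    × ∑ n (λ j → c j * proj₂ (v j)) ≡ y

_∈dil_·_ : Pt → ℕ → Gens → Set
q ∈dil k · V = Σ Pt λ p → (p ∈conv V) × (ℕ→ℚ k · p ≡ q)

Interior : Gens → Pt → Set
Interior V (x , y) =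
  Σ ℚ λ ε → (0ℚ < ε) ×
    ((x' y' : ℚ) → ∣ x' - x ∣ < ε → ∣ y' - y ∣ < ε → (x' , y') ∈conv V)

Boundary : Gens → Pt → Set
Boundary V p = (p ∈conv V) × ¬ Interior V p

IsVertex : Gens → Pt → Set
IsVertex V v = (v ∈conv V) ×
  ((p q : Pt) (t : ℚ) → p ∈conv V → q ∈conv V → 0ℚ < t → t < 1ℚ →
     v ≡ (proj₁ (t · p) + proj₁ ((1ℚ - t) · q) , proj₂ (t · p) + proj₂ ((1ℚ - t) · q)) →
     p ≡ q)

IntegralDilate : Gens → ℕ → Set
IntegralDilate V d = (v : Pt) → IsVertex V v → IsLatticePt (ℕ→ℚ d · v)

HasDenominator : Gens → ℕ → Set
HasDenominator V d = (1 ℕ.≤ d) × IntegralDilate V d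
  × ((d' : ℕ) → 1 ℕ.≤ d' → IntegralDilate V d' → d ℕ.≤ d')

HasCard : (ℤ × ℤ → Set) → ℕ → Set
HasCard S n = Σ (Fin n → ℤ × ℤ) λ f →
  ((j k : Fin n) → f j ≡ f k → j ≡ k)
  × ((j : Fin n) → S (f j))
  × ((z : ℤ × ℤ) → S z → ∃ λ j → f j ≡ z)

-- polynomial evaluation, coefficients listed from the constant term upward
evalPoly : List ℚ → ℚ → ℚ
evalPoly []       t = 0ℚ
evalPoly (c ∷ cs) t = c + t * evalPoly cs t

PseudoIntegral : Gens → Set
PseudoIntegral V = Σ (List ℚ) λ cs → (k : ℕ) → 1 ℕ.≤ k →
  Σ ℕ λ L → HasCard (λ z → ℤ²→Pt z ∈dil k · V) L × ℕ→ℚ L ≡ evalPoly cs (ℕ→ℚ k)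

P2 : ℕ → ℕ → Gens
P2 i b = gens 5 v
  where
  v : Fin 5 → Pt
  v fz = (0ℚ , (+ 3) / 2)
  v (fs fz) = (0ℚ , 1ℚ)
  v (fs (fs fz)) = (ℤ→ℚ ((+ (2 ℕ.* i ℕ.+ 7)) ℤ.- (+ b)) , 0ℚ)
  v (fs (fs (fs fz))) = (ℕ→ℚ (2 ℕ.* i ℕ.+ 4) , 0ℚ)
  v (fs (fs (fs (fs fz)))) = (ℕ→ℚ (2 ℕ.* i ℕ.+ 2) , (+ 1) / 2)

module Submission where

-- P is cut out by the five half-planes x ≥ 0, y ≥ 0, x + a y ≥ a, x + 4 y ≤ 2i + 4 and
-- x + (2i + 2) y ≤ 3i + 3, where a = 2i + 7 − b: each of them holds at the five generators, and
-- conversely a fan triangulation from (0, 1) writes every solution as a convex combination of them.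
-- The lattice points of kP are therefore counted row by row: row y consists of the x with
-- a (k − y)⁺ ≤ x ≤ min((2i + 4) k − 4 y, (3i + 3) k − (2i + 2) y), and summing over the rows gives
-- 2 |kP ∩ ℤ²| = (2i + b − 2) k² + b k + 2 for every k ≥ 1.  For k = 1 the lattice points are
-- (x, 0) with a ≤ x ≤ 2i + 4 and (x, 1) with 0 ≤ x ≤ i + 1; those strictly inside all five
-- half-planes are interior, and the others lie on a facet.  Finally, twice every vertex is integral
-- while the vertex (0, 3/2) is not, so the denominator is 2.

open import Level using (0ℓ)
open import Data.Empty using (⊥; ⊥-elim)
open import Data.Fin using (Fin; toℕ; fromℕ<; splitAt; _↑ˡ_; _↑ʳ_) renaming (zero to fz; suc to fs)
import Data.Fin.Properties as FinP
import Data.Integer as ℤ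
import Data.Integer.Properties as ℤP
open import Data.List using (List; []; _∷_)
open import Data.List.Relation.Unary.All as All using (All; []; _∷_)
open import Data.Maybe.Base using (Maybe; just; nothing)
import Data.Nat as ℕ
import Data.Nat.Coprimality as Coprime
import Data.Nat.DivMod
import Data.Nat.Properties as ℕP
open import Data.Nat.Tactic.RingSolver using (solve-∀)
open import Data.Product using (Σ; ∃; ∃₂; _×_; _,_; proj₁; proj₂)
import Data.Rational as ℚ
open import Data.Rational.Literals using (fromℤ)
import Data.Rational.Properties as ℚP
open import Data.Sum using (_⊎_; inj₁; inj₂; [_,_]′)
open import Function using (_∘_; _⇔_; mk⇔; Equivalence)
open import Relation.Binary using (tri<; tri≈; tri>)
open import Relation.Binary.PropositionalEquality
open import Relation.Nullary using (¬_; yes; no)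
open import Tactic.RingSolver using () renaming (solve-∀ to ring-solve-∀)
open import Tactic.RingSolver.Core.AlmostCommutativeRing using (AlmostCommutativeRing; fromCommutativeRing)

open import Defs

module _ where
  open ℕ using (ℕ; suc)
  open ℤ using (+_; -[1+_])
  open ℚ using (ℚ; _/_; 0ℚ; 1ℚ; _+_; _*_; _-_; -_; _≤_; _<_; 1/_)

  -- For `ring-solve-∀ ℚ-ring`: the library ships reflective ring solvers only for ℕ and ℤ.
  ℚ-ring : AlmostCommutativeRing 0ℓ 0ℓ
  ℚ-ring = fromCommutativeRing ℚP.+-*-commutativeRing is-zero
    where
    is-zero : (x : ℚ) → Maybe (0ℚ ≡ x)
    is-zero x with 0ℚ ℚP.≟ x
    ... | yes 0≡x = just 0≡x
    ... | no _    = nothing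

  ℤ→ℚ≡fromℤ : ∀ z → ℤ→ℚ z ≡ fromℤ z
  ℤ→ℚ≡fromℤ (+ n)    = ℚP.normalize-coprime (Coprime.sym (Coprime.1-coprimeTo n))
  ℤ→ℚ≡fromℤ -[1+ n ] = cong -_ (ℚP.normalize-coprime (Coprime.sym (Coprime.1-coprimeTo (suc n))))

  ℤ→ℚ-+ : ∀ m n → ℤ→ℚ (m ℤ.+ n) ≡ ℤ→ℚ m + ℤ→ℚ n
  ℤ→ℚ-+ m n = begin
    ℤ→ℚ (m ℤ.+ n)                     ≡⟨ cong₂ (λ u v → (u ℤ.+ v) / 1) (sym (ℤP.*-identityʳ m)) (sym (ℤP.*-identityʳ n)) ⟩
    (m ℤ.* + 1 ℤ.+ n ℤ.* + 1) / 1     ≡⟨ sym (cong₂ _+_ (ℤ→ℚ≡fromℤ m) (ℤ→ℚ≡fromℤ n)) ⟩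
    ℤ→ℚ m + ℤ→ℚ n                     ∎
    where open ≡-Reasoning

  ℤ→ℚ-* : ∀ m n → ℤ→ℚ (m ℤ.* n) ≡ ℤ→ℚ m * ℤ→ℚ n
  ℤ→ℚ-* m n = sym (cong₂ _*_ (ℤ→ℚ≡fromℤ m) (ℤ→ℚ≡fromℤ n))

  ℤ→ℚ-mono-≤ : ∀ {m n} → m ℤ.≤ n → ℤ→ℚ m ≤ ℤ→ℚ n
  ℤ→ℚ-mono-≤ {m} {n} m≤n = subst₂ _≤_ (sym (ℤ→ℚ≡fromℤ m)) (sym (ℤ→ℚ≡fromℤ n))
    (ℚ.*≤* (subst₂ ℤ._≤_ (sym (ℤP.*-identityʳ m)) (sym (ℤP.*-identityʳ n)) m≤n))

  ℤ→ℚ-cancel-≤ : ∀ {m n} → ℤ→ℚ m ≤ ℤ→ℚ n → m ℤ.≤ n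
  ℤ→ℚ-cancel-≤ {m} {n} m≤n = subst₂ ℤ._≤_ (ℤP.*-identityʳ m) (ℤP.*-identityʳ n)
    (ℚP.drop-*≤* (subst₂ _≤_ (ℤ→ℚ≡fromℤ m) (ℤ→ℚ≡fromℤ n) m≤n))

  ℕ→ℚ-+ : ∀ m n → ℕ→ℚ (m ℕ.+ n) ≡ ℕ→ℚ m + ℕ→ℚ n
  ℕ→ℚ-+ m n = ℤ→ℚ-+ (+ m) (+ n)

  ℕ→ℚ-* : ∀ m n → ℕ→ℚ (m ℕ.* n) ≡ ℕ→ℚ m * ℕ→ℚ n
  ℕ→ℚ-* m n = trans (cong ℤ→ℚ (ℤP.pos-* m n)) (ℤ→ℚ-* (+ m) (+ n))

  ℕ→ℚ-mono-≤ : ∀ {m n} → m ℕ.≤ n → ℕ→ℚ m ≤ ℕ→ℚ n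
  ℕ→ℚ-mono-≤ m≤n = ℤ→ℚ-mono-≤ (ℤ.+≤+ m≤n)

  ℕ→ℚ-cancel-≤ : ∀ {m n} → ℕ→ℚ m ≤ ℕ→ℚ n → m ℕ.≤ n
  ℕ→ℚ-cancel-≤ m≤n = ℤP.drop‿+≤+ (ℤ→ℚ-cancel-≤ m≤n)

  ℕ→ℚ-nonNeg : ∀ n → 0ℚ ≤ ℕ→ℚ n
  ℕ→ℚ-nonNeg n = ℕ→ℚ-mono-≤ {0} {n} ℕ.z≤n

  ℕ→ℚ-pos : ∀ n .{{_ : ℕ.NonZero n}} → 0ℚ < ℕ→ℚ n
  ℕ→ℚ-pos (suc n) = ℚP.<-≤-trans (ℚP.positive⁻¹ 1ℚ) (ℕ→ℚ-mono-≤ {1} {suc n} (ℕ.s≤s ℕ.z≤n))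

  ℕ→ℚ-affine : ∀ m n c → ℕ→ℚ (m ℕ.* n ℕ.+ c) ≡ ℕ→ℚ m * ℕ→ℚ n + ℕ→ℚ c
  ℕ→ℚ-affine m n c = trans (ℕ→ℚ-+ (m ℕ.* n) c) (cong (_+ ℕ→ℚ c) (ℕ→ℚ-* m n))

  nonNeg+ : ∀ {p q} → 0ℚ ≤ p → 0ℚ ≤ q → 0ℚ ≤ p + q
  nonNeg+ = ℚP.+-mono-≤

  nonNeg* : ∀ {p q} → 0ℚ ≤ p → 0ℚ ≤ q → 0ℚ ≤ p * q
  nonNeg* {p} {q} 0≤p 0≤q = ℚP.nonNegative⁻¹ (p * q)
    {{ℚP.nonNeg*nonNeg⇒nonNeg p {{ℚ.nonNegative 0≤p}} q {{ℚ.nonNegative 0≤q}}}}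

  pos* : ∀ {p q} → 0ℚ < p → 0ℚ < q → 0ℚ < p * q
  pos* {p} {q} 0<p 0<q = ℚP.positive⁻¹ (p * q)
    {{ℚP.pos*pos⇒pos p {{ℚ.positive 0<p}} q {{ℚ.positive 0<q}}}}

  recip : (r : ℚ) → 0ℚ < r → ℚ
  recip r 0<r = (1/ r) {{ℚP.pos⇒nonZero r {{ℚ.positive 0<r}}}}

  *-recip : ∀ r (0<r : 0ℚ < r) → r * recip r 0<r ≡ 1ℚ
  *-recip r 0<r = ℚP.*-inverseʳ r {{ℚP.pos⇒nonZero r {{ℚ.positive 0<r}}}}

  recip-pos : ∀ r (0<r : 0ℚ < r) → 0ℚ < recip r 0<r
  recip-pos r 0<r = ℚP.positive⁻¹ _ {{ℚP.1/pos⇒pos r {{ℚ.positive 0<r}}}}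

  pos-*-cancelˡ : ∀ {c p q} → 0ℚ < c → c * p ≡ c * q → p ≡ q
  pos-*-cancelˡ {c} 0<c cp≡cq = ℚP.≤-antisym (cancel (ℚP.≤-reflexive cp≡cq)) (cancel (ℚP.≤-reflexive (sym cp≡cq)))
    where
    cancel : ∀ {u v} → c * u ≤ c * v → u ≤ v
    cancel = ℚP.*-cancelˡ-≤-pos c {{ℚ.positive 0<c}}

-- Convex hulls

module _ where
  open ℕ using (zero; suc)
  open ℚ using (ℚ; 0ℚ; 1ℚ; _+_; _*_; _-_; -_; _≤_; _<_)

  ∑-cong : ∀ n {f g : Fin n → ℚ} → (∀ j → f j ≡ g j) → ∑ n f ≡ ∑ n g
  ∑-cong zero    f≗g = refl
  ∑-cong (suc n) f≗g = cong₂ _+_ (f≗g fz) (∑-cong n (λ j → f≗g (fs j)))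

  ∑-nonNeg : ∀ n {f : Fin n → ℚ} → (∀ j → 0ℚ ≤ f j) → 0ℚ ≤ ∑ n f
  ∑-nonNeg zero    0≤f = ℚP.≤-refl
  ∑-nonNeg (suc n) 0≤f = nonNeg+ (0≤f fz) (∑-nonNeg n (λ j → 0≤f (fs j)))

  ∑-*ˡ : ∀ n r (f : Fin n → ℚ) → ∑ n (λ j → r * f j) ≡ r * ∑ n f
  ∑-*ˡ zero    r f = sym (ℚP.*-zeroʳ r)
  ∑-*ˡ (suc n) r f = trans (cong (r * f fz +_) (∑-*ˡ n r (λ j → f (fs j))))
                           (sym (ℚP.*-distribˡ-+ r (f fz) _))

  ∑-affine : ∀ n (c x y : Fin n → ℚ) α β δ →
    ∑ n (λ j → c j * (α * x j + β * y j + δ))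
      ≡ α * ∑ n (λ j → c j * x j) + β * ∑ n (λ j → c j * y j) + δ * ∑ n c
  ∑-affine zero    c x y α β δ = zero-identity α β δ
    where
    zero-identity : ∀ α β δ → 0ℚ ≡ α * 0ℚ + β * 0ℚ + δ * 0ℚ
    zero-identity = ring-solve-∀ ℚ-ring
  ∑-affine (suc n) c x y α β δ =
    trans (cong (c fz * (α * x fz + β * y fz + δ) +_) (∑-affine n (c ∘ fs) (x ∘ fs) (y ∘ fs) α β δ))
          (step α β δ (c fz) (x fz) (y fz) _ _ _)
    where
    step : ∀ α β δ c₀ x₀ y₀ Sx Sy Sc → c₀ * (α * x₀ + β * y₀ + δ) + (α * Sx + β * Sy + δ * Sc)
                                  ≡ α * (c₀ * x₀ + Sx) + β * (c₀ * y₀ + Sy) + δ * (c₀ + Sc)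
    step = ring-solve-∀ ℚ-ring

  ∑-zeros : ∀ n → ∑ n (λ _ → 0ℚ) ≡ 0ℚ
  ∑-zeros zero    = refl
  ∑-zeros (suc n) = cong (0ℚ +_) (∑-zeros n)

  nonNeg+≡0 : ∀ {p q} → 0ℚ ≤ p → 0ℚ ≤ q → p + q ≡ 0ℚ → p ≡ 0ℚ × q ≡ 0ℚ
  nonNeg+≡0 {p} {q} 0≤p 0≤q p+q≡0 =
    ℚP.≤-antisym (bound 0≤q p+q≡0) 0≤p ,
    ℚP.≤-antisym (bound 0≤p (trans (ℚP.+-comm q p) p+q≡0)) 0≤q
    where
    bound : ∀ {u v} → 0ℚ ≤ v → u + v ≡ 0ℚ → u ≤ 0ℚ
    bound {u} {v} 0≤v u+v≡0 = subst₂ _≤_ (ℚP.+-identityʳ u) u+v≡0 (ℚP.+-monoʳ-≤ u 0≤v)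

  ∑-null-weights : ∀ n (c f : Fin n → ℚ) → (∀ j → 0ℚ ≤ c j) → ∑ n c ≡ 0ℚ →
    ∑ n (λ j → c j * f j) ≡ 0ℚ
  ∑-null-weights zero    c f 0≤c ∑c≡0 = refl
  ∑-null-weights (suc n) c f 0≤c ∑c≡0 =
    cong₂ _+_ (trans (cong (_* f fz) (proj₁ parts)) (ℚP.*-zeroˡ (f fz)))
              (∑-null-weights n (c ∘ fs) (f ∘ fs) (0≤c ∘ fs) (proj₂ parts))
    where
    parts : c fz ≡ 0ℚ × ∑ n (c ∘ fs) ≡ 0ℚ
    parts = nonNeg+≡0 (0≤c fz) (∑-nonNeg n (0≤c ∘ fs)) ∑c≡0

  conv-affine : ∀ m (w : Fin m → Pt) α β δ {x y} →
    (∀ j → 0ℚ ≤ α * proj₁ (w j) + β * proj₂ (w j) + δ) →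
    (x , y) ∈conv gens m w → 0ℚ ≤ α * x + β * y + δ
  conv-affine m w α β δ {x} {y} 0≤w (c , 0≤c , ∑c≡1 , ∑cx≡x , ∑cy≡y) =
    subst (0ℚ ≤_) combination (∑-nonNeg m (λ j → nonNeg* (0≤c j) (0≤w j)))
    where
    open ≡-Reasoning
    combination : ∑ m (λ j → c j * (α * proj₁ (w j) + β * proj₂ (w j) + δ)) ≡ α * x + β * y + δ
    combination = begin
      ∑ m (λ j → c j * (α * proj₁ (w j) + β * proj₂ (w j) + δ))
        ≡⟨ ∑-affine m c (proj₁ ∘ w) (proj₂ ∘ w) α β δ ⟩
      α * ∑ m (λ j → c j * proj₁ (w j)) + β * ∑ m (λ j → c j * proj₂ (w j)) + δ * ∑ m c
        ≡⟨ cong₂ (λ u v → α * u + β * v + δ * ∑ m c) ∑cx≡x ∑cy≡y ⟩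
      α * x + β * y + δ * ∑ m c
        ≡⟨ cong (λ s → α * x + β * y + δ * s) ∑c≡1 ⟩
      α * x + β * y + δ * 1ℚ
        ≡⟨ cong (α * x + β * y +_) (ℚP.*-identityʳ δ) ⟩
      α * x + β * y + δ ∎

  head∈conv : ∀ m (w : Fin (suc m) → Pt) → w fz ∈conv gens (suc m) w
  head∈conv m w = indicator , indicator-nonNeg , cong (1ℚ +_) (∑-zeros m) , at proj₁ , at proj₂
    where
    indicator : Fin (suc m) → ℚ
    indicator fz     = 1ℚ
    indicator (fs _) = 0ℚ
    indicator-nonNeg : ∀ j → 0ℚ ≤ indicator j
    indicator-nonNeg fz     = ℚP.<⇒≤ (ℚP.positive⁻¹ 1ℚ)
    indicator-nonNeg (fs _) = ℚP.≤-refl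
    at : (π : Pt → ℚ) → ∑ (suc m) (λ j → indicator j * π (w j)) ≡ π (w fz)
    at π = trans (cong₂ _+_ (ℚP.*-identityˡ (π (w fz)))
                            (∑-null-weights m (λ _ → 0ℚ) (π ∘ w ∘ fs) (λ _ → ℚP.≤-refl) (∑-zeros m)))
                 (ℚP.+-identityʳ (π (w fz)))

  tail⊆conv : ∀ m (w : Fin (suc m) → Pt) {p} → p ∈conv gens m (w ∘ fs) → p ∈conv gens (suc m) w
  tail⊆conv m w (c , 0≤c , ∑c≡1 , ∑cx≡x , ∑cy≡y) =
    c′ , c′-nonNeg , trans (ℚP.+-identityˡ _) ∑c≡1 , skip-head proj₁ ∑cx≡x , skip-head proj₂ ∑cy≡y
    where
    c′ : Fin (suc m) → ℚ
    c′ fz     = 0ℚ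
    c′ (fs j) = c j
    c′-nonNeg : ∀ j → 0ℚ ≤ c′ j
    c′-nonNeg fz     = ℚP.≤-refl
    c′-nonNeg (fs j) = 0≤c j
    skip-head : ∀ (π : Pt → ℚ) {z} → ∑ m (λ j → c j * π (w (fs j))) ≡ z →
                ∑ (suc m) (λ j → c′ j * π (w j)) ≡ z
    skip-head π ∑≡z = trans (cong (_+ ∑ m (λ j → c j * π (w (fs j)))) (ℚP.*-zeroˡ (π (w fz))))
                            (trans (ℚP.+-identityˡ _) ∑≡z)

  mix : ℚ → Pt → Pt → Pt
  mix t p q = proj₁ (t · p) + proj₁ ((1ℚ - t) · q) , proj₂ (t · p) + proj₂ ((1ℚ - t) · q)

  unit-interval-cases : ∀ {t} → 0ℚ ≤ t → t ≤ 1ℚ → t ≡ 0ℚ ⊎ (0ℚ < t × t < 1ℚ) ⊎ t ≡ 1ℚ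
  unit-interval-cases {t} 0≤t t≤1 with ℚP.<-cmp 0ℚ t | ℚP.<-cmp t 1ℚ
  ... | tri≈ _ 0≡t _ | _            = inj₁ (sym 0≡t)
  ... | tri> _ _ t<0 | _            = ⊥-elim (ℚP.<-irrefl refl (ℚP.<-≤-trans t<0 0≤t))
  ... | tri< 0<t _ _ | tri< t<1 _ _ = inj₂ (inj₁ (0<t , t<1))
  ... | tri< _ _ _   | tri≈ _ t≡1 _ = inj₂ (inj₂ t≡1)
  ... | tri< _ _ _   | tri> _ _ 1<t = ⊥-elim (ℚP.<-irrefl refl (ℚP.<-≤-trans 1<t t≤1))

  mix-idem : ∀ t p → mix t p p ≡ p
  mix-idem t (x , y) = cong₂ _,_ (collapse t x) (collapse t y)
    where
    collapse : ∀ t z → t * z + (1ℚ - t) * z ≡ z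
    collapse = ring-solve-∀ ℚ-ring

  tail-weight : ∀ m (c : Fin (suc m) → ℚ) → ∑ (suc m) c ≡ 1ℚ → ∑ m (c ∘ fs) ≡ 1ℚ - c fz
  tail-weight m c ∑c≡1 = trans (rearrange (c fz) (∑ m (c ∘ fs))) (cong (_- c fz) ∑c≡1)
    where
    rearrange : ∀ c₀ S → S ≡ (c₀ + S) - c₀
    rearrange = ring-solve-∀ ℚ-ring

  head-weight≤1 : ∀ m (c : Fin (suc m) → ℚ) → (∀ j → 0ℚ ≤ c j) → ∑ (suc m) c ≡ 1ℚ → c fz ≤ 1ℚ
  head-weight≤1 m c 0≤c ∑c≡1 = subst₂ _≤_ (ℚP.+-identityʳ (c fz)) ∑c≡1 (ℚP.+-monoʳ-≤ (c fz) (∑-nonNeg m (0≤c ∘ fs)))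

  head-weight-one : ∀ {m} {w : Fin (suc m) → Pt} {x y} (p∈ : (x , y) ∈conv gens (suc m) w) →
    proj₁ p∈ fz ≡ 1ℚ → (x , y) ≡ w fz
  head-weight-one {m} {w} (c , 0≤c , ∑c≡1 , ∑cx≡x , ∑cy≡y) c₀≡1 =
    cong₂ _,_ (at-head proj₁ ∑cx≡x) (at-head proj₂ ∑cy≡y)
    where
    tail≡0 : ∑ m (c ∘ fs) ≡ 0ℚ
    tail≡0 = trans (tail-weight m c ∑c≡1) (cong (λ t → 1ℚ - t) c₀≡1)
    at-head : ∀ (π : Pt → ℚ) {z} → ∑ (suc m) (λ j → c j * π (w j)) ≡ z → z ≡ π (w fz)
    at-head π {z} ∑≡z = begin
      z                                                 ≡⟨ sym ∑≡z ⟩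
      c fz * π (w fz) + ∑ m (λ j → c (fs j) * π (w (fs j)))
                                                        ≡⟨ cong₂ (λ u v → u * π (w fz) + v) c₀≡1
                                                             (∑-null-weights m (c ∘ fs) (π ∘ w ∘ fs) (0≤c ∘ fs) tail≡0) ⟩
      1ℚ * π (w fz) + 0ℚ                                ≡⟨ trans (ℚP.+-identityʳ _) (ℚP.*-identityˡ _) ⟩
      π (w fz)                                          ∎
      where open ≡-Reasoning

  head-weight-zero : ∀ {m} {w : Fin (suc m) → Pt} {x y} (p∈ : (x , y) ∈conv gens (suc m) w) →
    proj₁ p∈ fz ≡ 0ℚ → (x , y) ∈conv gens m (w ∘ fs)
  head-weight-zero {m} {w} (c , 0≤c , ∑c≡1 , ∑cx≡x , ∑cy≡y) c₀≡0 =
    c ∘ fs , 0≤c ∘ fs , trans (tail-weight m c ∑c≡1) (cong (λ t → 1ℚ - t) c₀≡0) ,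
    drop-head proj₁ ∑cx≡x , drop-head proj₂ ∑cy≡y
    where
    drop-head : ∀ (π : Pt → ℚ) {z} → ∑ (suc m) (λ j → c j * π (w j)) ≡ z → ∑ m (λ j → c (fs j) * π (w (fs j))) ≡ z
    drop-head π ∑≡z = trans (sym (ℚP.+-identityˡ _))
                            (trans (cong (_+ ∑ m (λ j → c (fs j) * π (w (fs j)))) (sym (trans (cong (_* π (w fz)) c₀≡0) (ℚP.*-zeroˡ (π (w fz)))))) ∑≡z)

  split-off-head : ∀ {m} {w : Fin (suc m) → Pt} {x y} (p∈ : (x , y) ∈conv gens (suc m) w) →
    proj₁ p∈ fz < 1ℚ → ∃ λ q → q ∈conv gens m (w ∘ fs) × (x , y) ≡ mix (proj₁ p∈ fz) (w fz) q
  split-off-head {m} {w} (c , 0≤c , ∑c≡1 , ∑cx≡x , ∑cy≡y) c₀<1 =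
    (r * tail-sum proj₁ , r * tail-sum proj₂) , q∈ , cong₂ _,_ (split proj₁ ∑cx≡x) (split proj₂ ∑cy≡y)
    where
    0<1-c₀ : 0ℚ < 1ℚ - c fz
    0<1-c₀ = subst (_< 1ℚ - c fz) (ℚP.+-inverseʳ (c fz)) (ℚP.+-monoˡ-< (- c fz) c₀<1)
    r : ℚ
    r = recip (1ℚ - c fz) 0<1-c₀
    tail-sum : (Pt → ℚ) → ℚ
    tail-sum π = ∑ m (λ j → c (fs j) * π (w (fs j)))
    scaled : ∀ (π : Pt → ℚ) → ∑ m (λ j → (r * c (fs j)) * π (w (fs j))) ≡ r * tail-sum π
    scaled π = trans (∑-cong m (λ j → ℚP.*-assoc r (c (fs j)) (π (w (fs j))))) (∑-*ˡ m r _)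
    q∈ : (r * tail-sum proj₁ , r * tail-sum proj₂) ∈conv gens m (w ∘ fs)
    q∈ = (λ j → r * c (fs j)) ,
         (λ j → nonNeg* (ℚP.<⇒≤ (recip-pos (1ℚ - c fz) 0<1-c₀)) (0≤c (fs j))) ,
         trans (∑-*ˡ m r (c ∘ fs)) (trans (cong (r *_) (tail-weight m c ∑c≡1))
           (trans (ℚP.*-comm r (1ℚ - c fz)) (*-recip (1ℚ - c fz) 0<1-c₀))) ,
         scaled proj₁ , scaled proj₂
    split : ∀ (π : Pt → ℚ) {z} → ∑ (suc m) (λ j → c j * π (w j)) ≡ z →
            z ≡ c fz * π (w fz) + (1ℚ - c fz) * (r * tail-sum π)
    split π ∑≡z = trans (sym ∑≡z) (cong (c fz * π (w fz) +_) (sym (rescale (tail-sum π))))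
      where
      rescale : ∀ z → (1ℚ - c fz) * (r * z) ≡ z
      rescale z = trans (sym (ℚP.*-assoc (1ℚ - c fz) r z))
                        (trans (cong (_* z) (*-recip (1ℚ - c fz) 0<1-c₀)) (ℚP.*-identityˡ z))

  vertex⇒generator : ∀ m (w : Fin m → Pt) {p} → IsVertex (gens m w) p → ∃ λ j → p ≡ w j
  vertex⇒generator zero    w ((_ , _ , () , _) , _)
  vertex⇒generator (suc m) w {x , y} (p∈@(c , 0≤c , ∑c≡1 , _) , extreme) =
    by-cases (unit-interval-cases (0≤c fz) (head-weight≤1 m c 0≤c ∑c≡1))
    where
    by-cases : c fz ≡ 0ℚ ⊎ (0ℚ < c fz × c fz < 1ℚ) ⊎ c fz ≡ 1ℚ → ∃ λ j → (x , y) ≡ w j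
    by-cases (inj₁ c₀≡0) = lift (vertex⇒generator m (w ∘ fs) (head-weight-zero {w = w} p∈ c₀≡0 , extreme-in-tail))
      where
      extreme-in-tail : ∀ q q′ t → q ∈conv gens m (w ∘ fs) → q′ ∈conv gens m (w ∘ fs) →
                        0ℚ < t → t < 1ℚ → (x , y) ≡ mix t q q′ → q ≡ q′
      extreme-in-tail q q′ t q∈ q′∈ = extreme q q′ t (tail⊆conv m w q∈) (tail⊆conv m w q′∈)
      lift : (∃ λ j → (x , y) ≡ w (fs j)) → ∃ λ j → (x , y) ≡ w j
      lift (j , p≡wj) = fs j , p≡wj
    by-cases (inj₂ (inj₁ (0<c₀ , c₀<1))) = fz , at-head (split-off-head {w = w} p∈ c₀<1)
      where
      at-head : (∃ λ q → q ∈conv gens m (w ∘ fs) × (x , y) ≡ mix (c fz) (w fz) q) → (x , y) ≡ w fz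
      at-head (q , q∈ , p≡) = trans p≡ (trans (cong (mix (c fz) (w fz)) (sym w₀≡q)) (mix-idem (c fz) (w fz)))
        where
        w₀≡q : w fz ≡ q
        w₀≡q = extreme (w fz) q (c fz) (head∈conv m w) (tail⊆conv m w q∈) 0<c₀ c₀<1 p≡
    by-cases (inj₂ (inj₂ c₀≡1)) = fz , head-weight-one {w = w} p∈ c₀≡1

  ∈conv-cong : ∀ m {w w′ : Fin m → Pt} {p} → (∀ j → w j ≡ w′ j) → p ∈conv gens m w → p ∈conv gens m w′
  ∈conv-cong m w≗w′ (c , 0≤c , ∑c≡1 , ∑cx≡x , ∑cy≡y) =
    c , 0≤c , ∑c≡1 , trans (∑-cong m (λ j → cong (λ q → c j * proj₁ q) (sym (w≗w′ j)))) ∑cx≡x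
                   , trans (∑-cong m (λ j → cong (λ q → c j * proj₂ q) (sym (w≗w′ j)))) ∑cy≡y

-- Half-planes

module _ where
  open ℕ using (ℕ)
  open ℚ using (ℚ; 0ℚ; 1ℚ; _+_; _*_; _-_; -_; _≤_; _<_; ∣_∣)

  p≤q⇒0≤q-p : ∀ {p q} → p ≤ q → 0ℚ ≤ q - p
  p≤q⇒0≤q-p {p} {q} p≤q = subst (_≤ q - p) (ℚP.+-inverseʳ p) (ℚP.+-monoˡ-≤ (- p) p≤q)

  0≤q-p⇒p≤q : ∀ {p q} → 0ℚ ≤ q - p → p ≤ q
  0≤q-p⇒p≤q {p} {q} 0≤q-p = subst₂ _≤_ (ℚP.+-identityˡ p) (cancel p q) (ℚP.+-monoˡ-≤ p 0≤q-p)
    where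
    cancel : ∀ p q → q - p + p ≡ q
    cancel = ring-solve-∀ ℚ-ring

  record Form : Set where
    constructor form
    field
      cx cy c₀ : ℕ
  open Form

  -- ⟦ form a b c ⟧ x y k = a x + b y + c k is an affine form homogenised by the dilation factor k,
  -- so that one half-plane l ≼ r (meaning ⟦ l ⟧ ≤ ⟦ r ⟧) describes both P (k = 1) and kP.
  ⟦_⟧ : Form → ℚ → ℚ → ℚ → ℚ
  ⟦ form a b c ⟧ x y k = ℕ→ℚ a * x + ℕ→ℚ b * y + ℕ→ℚ c * k

  ⟦_⟧ℕ : Form → ℕ → ℕ → ℕ → ℕ
  ⟦ form a b c ⟧ℕ x y k = a ℕ.* x ℕ.+ b ℕ.* y ℕ.+ c ℕ.* k

  record HalfPlane : Set where
    constructor _≼_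
    field
      lhs rhs : Form
  open HalfPlane

  _∋[_]_ : HalfPlane → ℚ → Pt → Set
  (l ≼ r) ∋[ k ] (x , y) = ⟦ l ⟧ x y k ≤ ⟦ r ⟧ x y k

  _∋_ : HalfPlane → Pt → Set
  h ∋ p = h ∋[ 1ℚ ] p

  _∋ℕ[_]_ : HalfPlane → ℕ → ℕ × ℕ → Set
  (l ≼ r) ∋ℕ[ k ] (x , y) = ⟦ l ⟧ℕ x y k ℕ.≤ ⟦ r ⟧ℕ x y k

  Strict : HalfPlane → ℕ × ℕ → Set
  Strict (l ≼ r) (x , y) = ⟦ l ⟧ℕ x y 1 ℕ.< ⟦ r ⟧ℕ x y 1

  Tight : HalfPlane → ℕ × ℕ → Set
  Tight (l ≼ r) (x , y) = ⟦ l ⟧ℕ x y 1 ≡ ⟦ r ⟧ℕ x y 1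

  weight : HalfPlane → ℕ
  weight (l ≼ r) = (cx l ℕ.+ cy l) ℕ.+ (cx r ℕ.+ cy r)

  ⟦⟧-cast : ∀ f x y k → ⟦ f ⟧ (ℕ→ℚ x) (ℕ→ℚ y) (ℕ→ℚ k) ≡ ℕ→ℚ (⟦ f ⟧ℕ x y k)
  ⟦⟧-cast (form a b c) x y k = sym (begin
    ℕ→ℚ (a ℕ.* x ℕ.+ b ℕ.* y ℕ.+ c ℕ.* k)
      ≡⟨ trans (ℕ→ℚ-+ (a ℕ.* x ℕ.+ b ℕ.* y) (c ℕ.* k)) (cong (_+ ℕ→ℚ (c ℕ.* k)) (ℕ→ℚ-+ (a ℕ.* x) (b ℕ.* y))) ⟩
    ℕ→ℚ (a ℕ.* x) + ℕ→ℚ (b ℕ.* y) + ℕ→ℚ (c ℕ.* k)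
      ≡⟨ cong₂ _+_ (cong₂ _+_ (ℕ→ℚ-* a x) (ℕ→ℚ-* b y)) (ℕ→ℚ-* c k) ⟩
    ℕ→ℚ a * ℕ→ℚ x + ℕ→ℚ b * ℕ→ℚ y + ℕ→ℚ c * ℕ→ℚ k ∎)
    where open ≡-Reasoning

  ∋-cast : ∀ h k x y → h ∋[ ℕ→ℚ k ] (ℕ→ℚ x , ℕ→ℚ y) ⇔ h ∋ℕ[ k ] (x , y)
  ∋-cast (l ≼ r) k x y = mk⇔
    (λ le → ℕ→ℚ-cancel-≤ (subst₂ _≤_ (⟦⟧-cast l x y k) (⟦⟧-cast r x y k) le))
    (λ le → subst₂ _≤_ (sym (⟦⟧-cast l x y k)) (sym (⟦⟧-cast r x y k)) (ℕ→ℚ-mono-≤ le))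

  ⟦⟧-dilate : ∀ f s x y → ⟦ f ⟧ (s * x) (s * y) s ≡ s * ⟦ f ⟧ x y 1ℚ
  ⟦⟧-dilate (form a b c) s x y = identity (ℕ→ℚ a) (ℕ→ℚ b) (ℕ→ℚ c) s x y
    where
    identity : ∀ a b c s x y → a * (s * x) + b * (s * y) + c * s ≡ s * (a * x + b * y + c * 1ℚ)
    identity = ring-solve-∀ ℚ-ring

  ∋-dilate : ∀ h s → 0ℚ < s → ∀ x y → h ∋[ s ] (s * x , s * y) ⇔ h ∋ (x , y)
  ∋-dilate (l ≼ r) s 0<s x y = mk⇔
    (λ le → ℚP.*-cancelˡ-≤-pos s {{ℚ.positive 0<s}}
              (subst₂ _≤_ (⟦⟧-dilate l s x y) (⟦⟧-dilate r s x y) le))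
    (λ le → subst₂ _≤_ (sym (⟦⟧-dilate l s x y)) (sym (⟦⟧-dilate r s x y))
              (ℚP.*-monoˡ-≤-nonNeg s {{ℚ.nonNegative (ℚP.<⇒≤ 0<s)}} le))

  ∋-conv : ∀ h m (w : Fin m → Pt) {p} → (∀ j → h ∋ w j) → p ∈conv gens m w → h ∋ p
  ∋-conv (l ≼ r) m w {x , y} h∋w p∈ =
    0≤q-p⇒p≤q (subst (0ℚ ≤_) (sym (slack l r x y))
      (conv-affine m w α β δ (λ j → subst (0ℚ ≤_) (slack l r (proj₁ (w j)) (proj₂ (w j))) (p≤q⇒0≤q-p (h∋w j))) p∈))
    where
    α β δ : ℚ
    α = ℕ→ℚ (cx r) - ℕ→ℚ (cx l)
    β = ℕ→ℚ (cy r) - ℕ→ℚ (cy l)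
    δ = ℕ→ℚ (c₀ r) - ℕ→ℚ (c₀ l)
    slack : ∀ l r x y → ⟦ r ⟧ x y 1ℚ - ⟦ l ⟧ x y 1ℚ
                      ≡ (ℕ→ℚ (cx r) - ℕ→ℚ (cx l)) * x + (ℕ→ℚ (cy r) - ℕ→ℚ (cy l)) * y + (ℕ→ℚ (c₀ r) - ℕ→ℚ (c₀ l))
    slack (form a b c) (form a′ b′ c′) x y = identity (ℕ→ℚ a) (ℕ→ℚ b) (ℕ→ℚ c) (ℕ→ℚ a′) (ℕ→ℚ b′) (ℕ→ℚ c′) x y
      where
      identity : ∀ a b c a′ b′ c′ x y → a′ * x + b′ * y + c′ * 1ℚ - (a * x + b * y + c * 1ℚ)
                                        ≡ (a′ - a) * x + (b′ - b) * y + (c′ - c)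
      identity = ring-solve-∀ ℚ-ring

  p≤∣p∣ : ∀ p → p ≤ ∣ p ∣
  p≤∣p∣ p with ℚP.≤-total 0ℚ p
  ... | inj₁ 0≤p = ℚP.≤-reflexive (sym (ℚP.0≤p⇒∣p∣≡p 0≤p))
  ... | inj₂ p≤0 = ℚP.≤-trans p≤0 (ℚP.0≤∣p∣ p)

  ∣-∣<⇒bounds : ∀ {p q ε} → ∣ p - q ∣ < ε → q - ε ≤ p × p ≤ q + ε
  ∣-∣<⇒bounds {p} {q} {ε} ∣p-q∣<ε =
    0≤q-p⇒p≤q (subst (0ℚ ≤_) (lower p q ε) (p≤q⇒0≤q-p (below (- (p - q)) (ℚP.∣-p∣≡∣p∣ (p - q))))) ,
    0≤q-p⇒p≤q (subst (0ℚ ≤_) (upper p q ε) (p≤q⇒0≤q-p (below (p - q) refl)))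
    where
    below : ∀ d → ∣ d ∣ ≡ ∣ p - q ∣ → d ≤ ε
    below d ∣d∣≡ = ℚP.<⇒≤ (ℚP.≤-<-trans (p≤∣p∣ d) (subst (_< ε) (sym ∣d∣≡) ∣p-q∣<ε))
    lower : ∀ p q ε → ε - (- (p - q)) ≡ p - (q - ε)
    lower = ring-solve-∀ ℚ-ring
    upper : ∀ p q ε → ε - (p - q) ≡ (q + ε) - p
    upper = ring-solve-∀ ℚ-ring

  ⟦⟧-mono : ∀ f k {x x′ y y′} → x ≤ x′ → y ≤ y′ → ⟦ f ⟧ x y k ≤ ⟦ f ⟧ x′ y′ k
  ⟦⟧-mono (form a b c) k x≤x′ y≤y′ = ℚP.+-monoˡ-≤ (ℕ→ℚ c * k) (ℚP.+-mono-≤ (scale a x≤x′) (scale b y≤y′))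
    where
    scale : ∀ n {u v} → u ≤ v → ℕ→ℚ n * u ≤ ℕ→ℚ n * v
    scale n = ℚP.*-monoˡ-≤-nonNeg (ℕ→ℚ n) {{ℚ.nonNegative (ℕ→ℚ-nonNeg n)}}

  ⟦⟧-shift : ∀ f x y k e → ⟦ f ⟧ (x + e) (y + e) k ≡ ⟦ f ⟧ x y k + ℕ→ℚ (cx f ℕ.+ cy f) * e
  ⟦⟧-shift (form a b c) x y k e =
    trans (identity (ℕ→ℚ a) (ℕ→ℚ b) (ℕ→ℚ c) x y k e) (cong (λ s → ⟦ form a b c ⟧ x y k + s * e) (sym (ℕ→ℚ-+ a b)))
    where
    identity : ∀ a b c x y k e → a * (x + e) + b * (y + e) + c * k ≡ a * x + b * y + c * k + (a + b) * e
    identity = ring-solve-∀ ℚ-ring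

  strict⇒∋-nearby : ∀ h {x y ε x′ y′} → Strict h (x , y) → ℕ→ℚ (weight h) * ε ≤ 1ℚ →
    ∣ x′ - ℕ→ℚ x ∣ < ε → ∣ y′ - ℕ→ℚ y ∣ < ε → h ∋ (x′ , y′)
  strict⇒∋-nearby (l ≼ r) {x} {y} {ε} {x′} {y′} l<r wε≤1 near-x near-y = begin
    ⟦ l ⟧ x′ y′ 1ℚ                   ≤⟨ ⟦⟧-mono l 1ℚ (proj₂ x-bounds) (proj₂ y-bounds) ⟩
    ⟦ l ⟧ (X + ε) (Y + ε) 1ℚ         ≡⟨ ⟦⟧-shift l X Y 1ℚ ε ⟩
    L + wl * ε                       ≤⟨ 0≤q-p⇒p≤q (subst (0ℚ ≤_) (identity L R wl wr ε) slacks) ⟩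
    R + wr * (- ε)                   ≡⟨ sym (⟦⟧-shift r X Y 1ℚ (- ε)) ⟩
    ⟦ r ⟧ (X - ε) (Y - ε) 1ℚ         ≤⟨ ⟦⟧-mono r 1ℚ (proj₁ x-bounds) (proj₁ y-bounds) ⟩
    ⟦ r ⟧ x′ y′ 1ℚ                   ∎
    where
    open ℚP.≤-Reasoning
    X Y L R wl wr : ℚ
    X = ℕ→ℚ x
    Y = ℕ→ℚ y
    L = ⟦ l ⟧ X Y 1ℚ
    R = ⟦ r ⟧ X Y 1ℚ
    wl = ℕ→ℚ (cx l ℕ.+ cy l)
    wr = ℕ→ℚ (cx r ℕ.+ cy r)
    x-bounds : X - ε ≤ x′ × x′ ≤ X + ε
    x-bounds = ∣-∣<⇒bounds near-x
    y-bounds : Y - ε ≤ y′ × y′ ≤ Y + ε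
    y-bounds = ∣-∣<⇒bounds near-y
    L+1≤R : L + 1ℚ ≤ R
    L+1≤R = subst₂ _≤_ (trans (ℕ→ℚ-+ (⟦ l ⟧ℕ x y 1) 1) (cong (_+ 1ℚ) (sym (⟦⟧-cast l x y 1))))
                       (sym (⟦⟧-cast r x y 1))
                       (ℕ→ℚ-mono-≤ (subst (ℕ._≤ ⟦ r ⟧ℕ x y 1) (ℕP.+-comm 1 _) l<r))
    slacks : 0ℚ ≤ (R - (L + 1ℚ)) + (1ℚ - (wl + wr) * ε)
    slacks = nonNeg+ (p≤q⇒0≤q-p L+1≤R)
                     (p≤q⇒0≤q-p (subst (λ w → w * ε ≤ 1ℚ) (ℕ→ℚ-+ (cx l ℕ.+ cy l) (cx r ℕ.+ cy r)) wε≤1))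
    identity : ∀ L R wl wr ε → (R - (L + 1ℚ)) + (1ℚ - (wl + wr) * ε) ≡ (R + wr * (- ε)) - (L + wl * ε)
    identity = ring-solve-∀ ℚ-ring

  slope : Form → ℚ → ℚ → ℚ
  slope f u v = ℕ→ℚ (cx f) * u + ℕ→ℚ (cy f) * v

  ⟦⟧-ray : ∀ f x y k t u v → ⟦ f ⟧ (x + t * u) (y + t * v) k ≡ ⟦ f ⟧ x y k + t * slope f u v
  ⟦⟧-ray (form a b c) x y k t u v = identity (ℕ→ℚ a) (ℕ→ℚ b) (ℕ→ℚ c) x y k t u v
    where
    identity : ∀ a b c x y k t u v →
      a * (x + t * u) + b * (y + t * v) + c * k ≡ a * x + b * y + c * k + t * (a * u + b * v)
    identity = ring-solve-∀ ℚ-ring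

  tight⇒¬∋-along-ray : ∀ h {x y} u v → Tight h (x , y) → slope (rhs h) u v < slope (lhs h) u v →
    ∀ t → 0ℚ < t → ¬ h ∋ (ℕ→ℚ x + t * u , ℕ→ℚ y + t * v)
  tight⇒¬∋-along-ray (l ≼ r) {x} {y} u v l≡r r<l t 0<t l≤r = ℚP.<-irrefl refl (begin-strict
    ⟦ r ⟧ X Y 1ℚ + t * slope r u v   <⟨ ℚP.+-monoʳ-< (⟦ r ⟧ X Y 1ℚ) (ℚP.*-monoʳ-<-pos t {{ℚ.positive 0<t}} r<l) ⟩
    ⟦ r ⟧ X Y 1ℚ + t * slope l u v   ≡⟨ cong (_+ t * slope l u v) (sym L≡R) ⟩
    ⟦ l ⟧ X Y 1ℚ + t * slope l u v   ≡⟨ sym (⟦⟧-ray l X Y 1ℚ t u v) ⟩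
    ⟦ l ⟧ (X + t * u) (Y + t * v) 1ℚ ≤⟨ l≤r ⟩
    ⟦ r ⟧ (X + t * u) (Y + t * v) 1ℚ ≡⟨ ⟦⟧-ray r X Y 1ℚ t u v ⟩
    ⟦ r ⟧ X Y 1ℚ + t * slope r u v   ∎)
    where
    open ℚP.≤-Reasoning
    X Y : ℚ
    X = ℕ→ℚ x
    Y = ℕ→ℚ y
    L≡R : ⟦ l ⟧ X Y 1ℚ ≡ ⟦ r ⟧ X Y 1ℚ
    L≡R = trans (⟦⟧-cast l x y 1) (trans (cong ℕ→ℚ l≡r) (sym (⟦⟧-cast r x y 1)))

  All∋-conv : ∀ (H : List HalfPlane) m (w : Fin m → Pt) {p} → (∀ j → All (_∋ w j) H) →
    p ∈conv gens m w → All (_∋ p) H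
  All∋-conv []      m w w∈H p∈ = []
  All∋-conv (h ∷ H) m w w∈H p∈ = ∋-conv h m w (All.head ∘ w∈H) p∈ ∷ All∋-conv H m w (All.tail ∘ w∈H) p∈

-- Polygons described by half-planes

module _ where
  open ℕ using (NonZero)
  open ℤ using (+_)
  open ℚ using (ℚ; 0ℚ; 1ℚ; ½; _+_; _*_; _-_; -_; _≤_; _<_; ∣_∣)

  interior⇒∈conv : ∀ {V x y} → Interior V (x , y) → (x , y) ∈conv V
  interior⇒∈conv {x = x} {y} (ε , 0<ε , box) = box x y (centre x) (centre y)
    where
    centre : ∀ z → ∣ z - z ∣ < ε
    centre z = subst (λ d → ∣ d ∣ < ε) (sym (ℚP.+-inverseʳ z)) 0<ε

  not-interior-along-ray : ∀ {V x y} u v → ∣ u ∣ ≤ 1ℚ → ∣ v ∣ ≤ 1ℚ →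
    (∀ t → 0ℚ < t → ¬ (x + t * u , y + t * v) ∈conv V) → ¬ Interior V (x , y)
  not-interior-along-ray {x = x} {y} u v ∣u∣≤1 ∣v∣≤1 leaves (ε , 0<ε , box) =
    leaves t 0<t (box (x + t * u) (y + t * v) (moved x u ∣u∣≤1) (moved y v ∣v∣≤1))
    where
    open ℚP.≤-Reasoning
    t : ℚ
    t = ε * ½
    0<t : 0ℚ < t
    0<t = pos* 0<ε (ℚP.positive⁻¹ ½)
    t<ε : t < ε
    t<ε = subst₂ _<_ (ℚP.+-identityˡ t) (halves ε) (ℚP.+-monoˡ-< t 0<t)
      where
      halves : ∀ ε → ε * ½ + ε * ½ ≡ ε
      halves = ring-solve-∀ ℚ-ring
    moved : ∀ z w → ∣ w ∣ ≤ 1ℚ → ∣ z + t * w - z ∣ < ε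
    moved z w ∣w∣≤1 = begin-strict
      ∣ z + t * w - z ∣   ≡⟨ cong ∣_∣ (displacement z t w) ⟩
      ∣ t * w ∣           ≡⟨ ℚP.∣p*q∣≡∣p∣*∣q∣ t w ⟩
      ∣ t ∣ * ∣ w ∣       ≡⟨ cong (_* ∣ w ∣) (ℚP.0≤p⇒∣p∣≡p (ℚP.<⇒≤ 0<t)) ⟩
      t * ∣ w ∣           ≤⟨ ℚP.*-monoˡ-≤-nonNeg t {{ℚ.nonNegative (ℚP.<⇒≤ 0<t)}} ∣w∣≤1 ⟩
      t * 1ℚ              ≡⟨ ℚP.*-identityʳ t ⟩
      t                   <⟨ t<ε ⟩
      ε                   ∎
      where
      displacement : ∀ z t w → z + t * w - z ≡ t * w
      displacement = ring-solve-∀ ℚ-ring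

  tight⇒¬interior : ∀ h {V x y} → (∀ {p} → p ∈conv V → h ∋ p) → Tight h (x , y) →
    ∀ u v → ∣ u ∣ ≤ 1ℚ → ∣ v ∣ ≤ 1ℚ → slope (HalfPlane.rhs h) u v < slope (HalfPlane.lhs h) u v →
    ¬ Interior V (ℕ→ℚ x , ℕ→ℚ y)
  tight⇒¬interior h valid tight u v ∣u∣≤1 ∣v∣≤1 decreasing =
    not-interior-along-ray u v ∣u∣≤1 ∣v∣≤1
      (λ t 0<t p∈ → tight⇒¬∋-along-ray h u v tight decreasing t 0<t (valid p∈))

  ∈conv⇔∈dil₁ : ∀ V p → p ∈conv V ⇔ p ∈dil 1 · V
  ∈conv⇔∈dil₁ V (x , y) = mk⇔
    (λ p∈ → (x , y) , p∈ , unit x y)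
    (λ { (q , q∈ , 1·q≡p) → subst (_∈conv V) (trans (sym (unit (proj₁ q) (proj₂ q))) 1·q≡p) q∈ })
    where
    unit : ∀ x y → ℕ→ℚ 1 · (x , y) ≡ (x , y)
    unit x y = cong₂ _,_ (ℚP.*-identityˡ x) (ℚP.*-identityˡ y)

  module HDescription (V : Gens) (H : List HalfPlane)
    (sound : ∀ {p} → p ∈conv V → All (_∋ p) H)
    (complete : ∀ {p} → All (_∋ p) H → p ∈conv V) where

    ∈dil⇔ : ∀ k .{{_ : NonZero k}} x y → (x , y) ∈dil k · V ⇔ All (_∋[ ℕ→ℚ k ] (x , y)) H
    ∈dil⇔ k x y = mk⇔ to from
      where
      K : ℚ
      K = ℕ→ℚ k
      0<K : 0ℚ < K
      0<K = ℕ→ℚ-pos k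
      to : (x , y) ∈dil k · V → All (_∋[ K ] (x , y)) H
      to ((px , py) , p∈ , refl) = All.map (λ {h} → Equivalence.from (∋-dilate h K 0<K px py)) (sound p∈)
      r : ℚ
      r = recip K 0<K
      unscale : ∀ z → K * (r * z) ≡ z
      unscale z = trans (sym (ℚP.*-assoc K r z)) (trans (cong (_* z) (*-recip K 0<K)) (ℚP.*-identityˡ z))
      from : All (_∋[ K ] (x , y)) H → (x , y) ∈dil k · V
      from q∈ = (r * x , r * y) ,
                complete (All.map (λ {h} h∋ → Equivalence.to (∋-dilate h K 0<K (r * x) (r * y))
                                       (subst (h ∋[ K ]_) (sym (cong₂ _,_ (unscale x) (unscale y))) h∋)) q∈) ,
                cong₂ _,_ (unscale x) (unscale y)

    lattice∈dil⇔ : ∀ k .{{_ : NonZero k}} x y → ℤ²→Pt (+ x , + y) ∈dil k · V ⇔ All (_∋ℕ[ k ] (x , y)) H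
    lattice∈dil⇔ k x y = mk⇔
      (All.map (λ {h} → Equivalence.to (∋-cast h k x y)) ∘ Equivalence.to (∈dil⇔ k (ℕ→ℚ x) (ℕ→ℚ y)))
      (Equivalence.from (∈dil⇔ k (ℕ→ℚ x) (ℕ→ℚ y)) ∘ All.map (λ {h} → Equivalence.from (∋-cast h k x y)))

    strict⇒interior : ∀ w .{{_ : NonZero w}} {x y} → All (λ h → weight h ℕ.≤ w) H →
      All (λ h → Strict h (x , y)) H → Interior V (ℕ→ℚ x , ℕ→ℚ y)
    strict⇒interior w weights stricts = ε , recip-pos W 0<W , λ x′ y′ near-x near-y →
      complete (All.zipWith (λ {h} (w-bound , strict) → strict⇒∋-nearby h strict (small w-bound) near-x near-y)
                            (weights , stricts))
      where
      W : ℚ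
      W = ℕ→ℚ w
      0<W : 0ℚ < W
      0<W = ℕ→ℚ-pos w
      ε : ℚ
      ε = recip W 0<W
      small : ∀ {n} → n ℕ.≤ w → ℕ→ℚ n * ε ≤ 1ℚ
      small n≤w = ℚP.≤-trans (ℚP.*-monoʳ-≤-nonNeg ε {{ℚ.nonNegative (ℚP.<⇒≤ (recip-pos W 0<W))}} (ℕ→ℚ-mono-≤ n≤w))
                             (ℚP.≤-reflexive (*-recip W 0<W))

  OnLine : HalfPlane → Pt → Set
  OnLine (l ≼ r) (x , y) = ⟦ l ⟧ x y 1ℚ ≡ ⟦ r ⟧ x y 1ℚ

  pos*nonNeg≡0 : ∀ {t a} → 0ℚ < t → 0ℚ ≤ a → t * a ≡ 0ℚ → a ≡ 0ℚ
  pos*nonNeg≡0 {t} 0<t 0≤a ta≡0 = ℚP.≤-antisym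
    (ℚP.*-cancelˡ-≤-pos t {{ℚ.positive 0<t}} (ℚP.≤-reflexive (trans ta≡0 (sym (ℚP.*-zeroʳ t))))) 0≤a

  onLine-split : ∀ h {px py qx qy} t → h ∋ (px , py) → h ∋ (qx , qy) → 0ℚ < t → t < 1ℚ →
    OnLine h (t * px + (1ℚ - t) * qx , t * py + (1ℚ - t) * qy) → OnLine h (px , py) × OnLine h (qx , qy)
  onLine-split (l ≼ r) {px} {py} {qx} {qy} t p∈h q∈h 0<t t<1 on-mid =
    from-slack (pos*nonNeg≡0 0<t 0≤sp (proj₁ parts)) , from-slack (pos*nonNeg≡0 0<1-t 0≤sq (proj₂ parts))
    where
    mx my sp sq : ℚ
    mx = t * px + (1ℚ - t) * qx
    my = t * py + (1ℚ - t) * qy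
    sp = ⟦ r ⟧ px py 1ℚ - ⟦ l ⟧ px py 1ℚ
    sq = ⟦ r ⟧ qx qy 1ℚ - ⟦ l ⟧ qx qy 1ℚ
    0≤sp : 0ℚ ≤ sp
    0≤sp = p≤q⇒0≤q-p p∈h
    0≤sq : 0ℚ ≤ sq
    0≤sq = p≤q⇒0≤q-p q∈h
    0<1-t : 0ℚ < 1ℚ - t
    0<1-t = subst (_< 1ℚ - t) (ℚP.+-inverseʳ t) (ℚP.+-monoˡ-< (- t) t<1)
    combination : ∀ f → ⟦ f ⟧ (t * px + (1ℚ - t) * qx) (t * py + (1ℚ - t) * qy) 1ℚ
                        ≡ t * ⟦ f ⟧ px py 1ℚ + (1ℚ - t) * ⟦ f ⟧ qx qy 1ℚ
    combination (form a b c) = identity (ℕ→ℚ a) (ℕ→ℚ b) (ℕ→ℚ c) t px py qx qy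
      where
      identity : ∀ a b c t px py qx qy →
        a * (t * px + (1ℚ - t) * qx) + b * (t * py + (1ℚ - t) * qy) + c * 1ℚ
          ≡ t * (a * px + b * py + c * 1ℚ) + (1ℚ - t) * (a * qx + b * qy + c * 1ℚ)
      identity = ring-solve-∀ ℚ-ring
    slack-mid : t * sp + (1ℚ - t) * sq ≡ 0ℚ
    slack-mid = trans (regroup t (⟦ l ⟧ px py 1ℚ) (⟦ r ⟧ px py 1ℚ) (⟦ l ⟧ qx qy 1ℚ) (⟦ r ⟧ qx qy 1ℚ))
                      (trans (cong₂ _-_ (sym (combination r)) (sym (combination l)))
                             (trans (cong (λ u → ⟦ r ⟧ mx my 1ℚ - u) on-mid) (ℚP.+-inverseʳ (⟦ r ⟧ mx my 1ℚ))))
      where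
      regroup : ∀ t lp rp lq rq → t * (rp - lp) + (1ℚ - t) * (rq - lq)
                                  ≡ (t * rp + (1ℚ - t) * rq) - (t * lp + (1ℚ - t) * lq)
      regroup = ring-solve-∀ ℚ-ring
    parts : t * sp ≡ 0ℚ × (1ℚ - t) * sq ≡ 0ℚ
    parts = nonNeg+≡0 (nonNeg* (ℚP.<⇒≤ 0<t) 0≤sp) (nonNeg* (ℚP.<⇒≤ 0<1-t) 0≤sq) slack-mid
    from-slack : ∀ {u v} → v - u ≡ 0ℚ → u ≡ v
    from-slack {u} {v} v-u≡0 = trans (sym (ℚP.+-identityˡ u)) (trans (cong (_+ u) (sym v-u≡0)) (restore u v))
      where
      restore : ∀ u v → v - u + u ≡ v
      restore = ring-solve-∀ ℚ-ring

-- Counting lattice points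

module _ where
  open ℕ using (ℕ; zero; suc; _+_; _*_; _∸_; _≤_; _<_; z≤n; s≤s)
  open ℤ using (ℤ)

  HasCard-cong : ∀ {S T : ℤ × ℤ → Set} {n} → (∀ z → S z → T z) → (∀ z → T z → S z) →
    HasCard S n → HasCard T n
  HasCard-cong S⊆T T⊆S (f , f-inj , f∈S , onto) = f , f-inj , (λ j → S⊆T (f j) (f∈S j)) , (λ z z∈T → onto z (T⊆S z z∈T))

  HasCard-singleton : ∀ z₀ → HasCard (_≡ z₀) 1
  HasCard-singleton z₀ = (λ _ → z₀) , (λ { fz fz _ → refl }) , (λ _ → refl) , (λ z z≡z₀ → fz , sym z≡z₀)

  HasCard-⊎ : ∀ {S T : ℤ × ℤ → Set} {m n} → (∀ z → S z → T z → ⊥) →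
    HasCard S m → HasCard T n → HasCard (λ z → S z ⊎ T z) (m + n)
  HasCard-⊎ {S} {T} {m} {n} disjoint (f , f-inj , f∈S , f-onto) (g , g-inj , g∈T , g-onto) =
    h , h-inj , h∈ , h-onto
    where
    h : Fin (m + n) → ℤ × ℤ
    h j = [ f , g ]′ (splitAt m j)
    h-inj : ∀ j j′ → h j ≡ h j′ → j ≡ j′
    h-inj j j′ eq with splitAt m j in ej | splitAt m j′ in ej′
    ... | inj₁ u | inj₁ u′ = trans (sym (FinP.splitAt⁻¹-↑ˡ ej)) (trans (cong (_↑ˡ n) (f-inj u u′ eq)) (FinP.splitAt⁻¹-↑ˡ ej′))
    ... | inj₁ u | inj₂ v′ = ⊥-elim (disjoint (f u) (f∈S u) (subst T (sym eq) (g∈T v′)))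
    ... | inj₂ v | inj₁ u′ = ⊥-elim (disjoint (f u′) (f∈S u′) (subst T eq (g∈T v)))
    ... | inj₂ v | inj₂ v′ = trans (sym (FinP.splitAt⁻¹-↑ʳ ej)) (trans (cong (m ↑ʳ_) (g-inj v v′ eq)) (FinP.splitAt⁻¹-↑ʳ ej′))
    h∈ : ∀ j → S (h j) ⊎ T (h j)
    h∈ j with splitAt m j
    ... | inj₁ u = inj₁ (f∈S u)
    ... | inj₂ v = inj₂ (g∈T v)
    h-onto : ∀ z → S z ⊎ T z → ∃ λ j → h j ≡ z
    h-onto z (inj₁ z∈S) with f-onto z z∈S
    ... | u , fu≡z = u ↑ˡ n , trans (cong [ f , g ]′ (FinP.splitAt-↑ˡ m u n)) fu≡z
    h-onto z (inj₂ z∈T) with g-onto z z∈T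
    ... | v , gv≡z = m ↑ʳ v , trans (cong [ f , g ]′ (FinP.splitAt-↑ʳ m n v)) gv≡z

  Segment : ℕ → ℕ → ℕ → ℤ × ℤ → Set
  Segment y lo n z = ∃ λ j → j < n × z ≡ (ℤ.+ (lo + j) , ℤ.+ y)

  HasCard-segment : ∀ y lo n → HasCard (Segment y lo n) n
  HasCard-segment y lo n = point , point-inj , (λ j → toℕ j , FinP.toℕ<n j , refl) , onto
    where
    point : Fin n → ℤ × ℤ
    point j = ℤ.+ (lo + toℕ j) , ℤ.+ y
    point-inj : ∀ j j′ → point j ≡ point j′ → j ≡ j′
    point-inj j j′ eq = FinP.toℕ-injective (ℕP.+-cancelˡ-≡ lo _ _ (ℤP.+-injective (cong proj₁ eq)))
    onto : ∀ z → Segment y lo n z → ∃ λ j → point j ≡ z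
    onto z (j , j<n , refl) = fromℕ< j<n , cong (λ i → ℤ.+ (lo + i) , ℤ.+ y) (FinP.toℕ-fromℕ< j<n)

  ∑ℕ : ℕ → (ℕ → ℕ) → ℕ
  ∑ℕ zero    f = 0
  ∑ℕ (suc n) f = ∑ℕ n f + f n

  Stack : ℕ → (ℕ → ℕ) → (ℕ → ℕ) → ℤ × ℤ → Set
  Stack n lo len z = ∃ λ y → y < n × Segment y (lo y) (len y) z

  HasCard-stack : ∀ n lo len → HasCard (Stack n lo len) (∑ℕ n len)
  HasCard-stack zero    lo len = (λ ()) , (λ ()) , (λ ()) , (λ { z (_ , () , _) })
  HasCard-stack (suc n) lo len =
    HasCard-cong to from (HasCard-⊎ disjoint (HasCard-stack n lo len) (HasCard-segment n (lo n) (len n)))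
    where
    disjoint : ∀ z → Stack n lo len z → Segment n (lo n) (len n) z → ⊥
    disjoint z (y , y<n , _ , _ , refl) (_ , _ , eq) = ℕP.<-irrefl (ℤP.+-injective (cong proj₂ eq)) y<n
    to : ∀ z → Stack n lo len z ⊎ Segment n (lo n) (len n) z → Stack (suc n) lo len z
    to z (inj₁ (y , y<n , z∈)) = y , ℕP.m<n⇒m<1+n y<n , z∈
    to z (inj₂ z∈)             = n , ℕP.n<1+n n , z∈
    from : ∀ z → Stack (suc n) lo len z → Stack n lo len z ⊎ Segment n (lo n) (len n) z
    from z (y , y<1+n , z∈) with ℕP.m<1+n⇒m<n∨m≡n y<1+n
    ... | inj₁ y<n  = inj₁ (y , y<n , z∈)
    ... | inj₂ refl = inj₂ z∈

  ∑ℕ-cong : ∀ n {f g : ℕ → ℕ} → (∀ y → y < n → f y ≡ g y) → ∑ℕ n f ≡ ∑ℕ n g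
  ∑ℕ-cong zero    f≗g = refl
  ∑ℕ-cong (suc n) f≗g = cong₂ _+_ (∑ℕ-cong n (λ y y<n → f≗g y (ℕP.m<n⇒m<1+n y<n))) (f≗g n (ℕP.n<1+n n))

  ∑ℕ-split : ∀ m n f → ∑ℕ (m + n) f ≡ ∑ℕ m f + ∑ℕ n (λ j → f (m + j))
  ∑ℕ-split m zero    f = trans (cong (λ l → ∑ℕ l f) (ℕP.+-identityʳ m)) (sym (ℕP.+-identityʳ _))
  ∑ℕ-split m (suc n) f = begin
    ∑ℕ (m + suc n) f                                         ≡⟨ cong (λ l → ∑ℕ l f) (ℕP.+-suc m n) ⟩
    ∑ℕ (m + n) f + f (m + n)                                 ≡⟨ cong (_+ f (m + n)) (∑ℕ-split m n f) ⟩
    ∑ℕ m f + ∑ℕ n (λ j → f (m + j)) + f (m + n)              ≡⟨ ℕP.+-assoc (∑ℕ m f) _ _ ⟩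
    ∑ℕ m f + (∑ℕ n (λ j → f (m + j)) + f (m + n))            ∎
    where open ≡-Reasoning

  ∑ℕ-zeros : ∀ n → ∑ℕ n (λ _ → 0) ≡ 0
  ∑ℕ-zeros zero    = refl
  ∑ℕ-zeros (suc n) = trans (ℕP.+-identityʳ _) (∑ℕ-zeros n)

  ∑ℕ-*ˡ : ∀ n c f → ∑ℕ n (λ y → c * f y) ≡ c * ∑ℕ n f
  ∑ℕ-*ˡ zero    c f = sym (ℕP.*-zeroʳ c)
  ∑ℕ-*ˡ (suc n) c f = trans (cong (_+ c * f n) (∑ℕ-*ˡ n c f)) (sym (ℕP.*-distribˡ-+ c (∑ℕ n f) (f n)))

  ∑ℕ-∸ : ∀ n f g → (∀ y → y < n → g y ≤ f y) → ∑ℕ n (λ y → f y ∸ g y) + ∑ℕ n g ≡ ∑ℕ n f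
  ∑ℕ-∸ zero    f g g≤f = refl
  ∑ℕ-∸ (suc n) f g g≤f = begin
    (∑ℕ n (λ y → f y ∸ g y) + (f n ∸ g n)) + (∑ℕ n g + g n)   ≡⟨ interchange (∑ℕ n (λ y → f y ∸ g y)) (f n ∸ g n) (∑ℕ n g) (g n) ⟩
    (∑ℕ n (λ y → f y ∸ g y) + ∑ℕ n g) + ((f n ∸ g n) + g n)   ≡⟨ cong₂ _+_ (∑ℕ-∸ n f g (λ y y<n → g≤f y (ℕP.m<n⇒m<1+n y<n)))
                                                                         (ℕP.m∸n+n≡m (g≤f n (ℕP.n<1+n n))) ⟩
    ∑ℕ n f + f n                                              ∎
    where
    open ≡-Reasoning
    interchange : ∀ a b c d → (a + b) + (c + d) ≡ (a + c) + (b + d)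
    interchange = solve-∀

  ∑ℕ-descending : ∀ n c d → (∀ y → y < n → d * y ≤ c) →
    2 * ∑ℕ n (λ y → c ∸ d * y) + d * (n * n) ≡ n * (2 * c) + d * n
  ∑ℕ-descending zero    c d dy≤c = refl
  ∑ℕ-descending (suc n) c d dy≤c = begin
    2 * (S + (c ∸ d * n)) + d * (suc n * suc n)          ≡⟨ regroup S (c ∸ d * n) d n ⟩
    (2 * S + d * (n * n)) + 2 * ((c ∸ d * n) + d * n) + d
      ≡⟨ cong₂ (λ u v → u + 2 * v + d) (∑ℕ-descending n c d (λ y y<n → dy≤c y (ℕP.m<n⇒m<1+n y<n)))
                                       (ℕP.m∸n+n≡m (dy≤c n (ℕP.n<1+n n))) ⟩
    (n * (2 * c) + d * n) + 2 * c + d                    ≡⟨ finish n c d ⟩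
    suc n * (2 * c) + d * suc n                          ∎
    where
    open ≡-Reasoning
    S : ℕ
    S = ∑ℕ n (λ y → c ∸ d * y)
    regroup : ∀ S s d n → 2 * (S + s) + d * (suc n * suc n) ≡ (2 * S + d * (n * n)) + 2 * (s + d * n) + d
    regroup = solve-∀
    finish : ∀ n c d → (n * (2 * c) + d * n) + 2 * c + d ≡ suc n * (2 * c) + d * suc n
    finish = solve-∀

  ≤-offset : ∀ {m n} o → m + o ≡ n → m ≤ n
  ≤-offset {m} o refl = ℕP.m≤m+n m o

  +≤⇔≤∸ : ∀ x n m → x + n ≤ m ⇔ (n ≤ m × x ≤ m ∸ n)
  +≤⇔≤∸ x n m = mk⇔ (λ x+n≤m → ℕP.m+n≤o⇒n≤o x x+n≤m , ℕP.m+n≤o⇒m≤o∸n x x+n≤m)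
                    (λ (n≤m , x≤m∸n) → ℕP.m≤o∸n⇒m+n≤o x n≤m x≤m∸n)

  ≤+*⇔*∸≤ : ∀ c k x y → c * k ≤ x + c * y ⇔ c * (k ∸ y) ≤ x
  ≤+*⇔*∸≤ c k x y = mk⇔ to from
    where
    to : c * k ≤ x + c * y → c * (k ∸ y) ≤ x
    to le = subst (_≤ x) (sym (ℕP.*-distribˡ-∸ c k y))
                  (ℕP.m≤n+o⇒m∸n≤o (c * k) (c * y) (subst (c * k ≤_) (ℕP.+-comm x (c * y)) le))
    from : c * (k ∸ y) ≤ x → c * k ≤ x + c * y
    from le = begin
      c * k                  ≤⟨ ℕP.m≤n+m∸n (c * k) (c * y) ⟩
      c * y + (c * k ∸ c * y) ≡⟨ cong (c * y +_) (sym (ℕP.*-distribˡ-∸ c k y)) ⟩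
      c * y + c * (k ∸ y)    ≤⟨ ℕP.+-monoʳ-≤ (c * y) le ⟩
      c * y + x              ≡⟨ ℕP.+-comm (c * y) x ⟩
      x + c * y              ∎
      where open ℕP.≤-Reasoning

  mixture-bound : ∀ {c₁ c₂ C k y} → c₁ ≤ C → c₂ ≤ C → y ≤ k → c₁ * (k ∸ y) + c₂ * y ≤ C * k
  mixture-bound {c₁} {c₂} {C} {k} {y} c₁≤C c₂≤C y≤k = begin
    c₁ * (k ∸ y) + c₂ * y   ≤⟨ ℕP.+-mono-≤ (ℕP.*-monoˡ-≤ (k ∸ y) c₁≤C) (ℕP.*-monoˡ-≤ y c₂≤C) ⟩
    C * (k ∸ y) + C * y     ≡⟨ sym (ℕP.*-distribˡ-+ C (k ∸ y) y) ⟩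
    C * (k ∸ y + y)         ≡⟨ cong (C *_) (ℕP.m∸n+n≡m y≤k) ⟩
    C * k                   ∎
    where open ℕP.≤-Reasoning

  bit² : ∀ {r} → r ≤ 1 → r * r ≡ r
  bit² z≤n       = refl
  bit² (s≤s z≤n) = refl

  segment-index : ∀ {l h x} → l ≤ x → x ≤ h → x ∸ l < suc h ∸ l
  segment-index l≤x x≤h = ℕP.∸-monoˡ-< (s≤s x≤h) l≤x

  segment-bound : ∀ {l h j} → j < suc h ∸ l → l + j ≤ h
  segment-bound {l} {h} {j} j<len = subst (_≤ h) (ℕP.+-comm j l) (ℕP.≤-pred (ℕP.m≤o∸n⇒m+n≤o (suc j) l≤1+h j<len))
    where
    l≤1+h : l ≤ suc h
    l≤1+h = ℕP.<⇒≤ (ℕP.m∸n≢0⇒n<m (λ len≡0 → ℕP.n≮0 (subst (j <_) len≡0 j<len)))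

-- The polygon and its facets

module _ where
  open ℕ using (ℕ; suc; _+_; _*_; _∸_; _≤_; z≤n)
  open ℚ using (0ℚ)

  -- i = e + 1 and b = d + 3, and a = 2i + 7 − b is the first coordinate of the third vertex.
  module Polygon (e a d : ℕ) (a+d≡ : a + d ≡ 2 * e + 6) where

    V : Gens
    V = P2 (suc e) (3 + d)

    left bottom slant right top : HalfPlane
    left   = form 0 0 0 ≼ form 1 0 0
    bottom = form 0 0 0 ≼ form 0 1 0
    slant  = form 0 0 a ≼ form 1 a 0
    right  = form 1 4 0 ≼ form 0 0 (2 * e + 6)
    top    = form 1 (2 * e + 4) 0 ≼ form 0 0 (3 * e + 6)

    facets : List HalfPlane
    facets = left ∷ bottom ∷ slant ∷ right ∷ top ∷ []

    record InDilate (k x y : ℕ) : Set where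
      field
        above-slant : a * k ≤ x + a * y
        below-right : x + 4 * y ≤ (2 * e + 6) * k
        below-top   : x + (2 * e + 4) * y ≤ (3 * e + 6) * k
    open InDilate

    ⟦x+cy⟧ℕ : ∀ c x y k → 1 * x + c * y + 0 * k ≡ x + c * y
    ⟦x+cy⟧ℕ = solve-∀

    facets⇔InDilate : ∀ k x y → All (_∋ℕ[ k ] (x , y)) facets ⇔ InDilate k x y
    facets⇔InDilate k x y = mk⇔ to from
      where
      to : All (_∋ℕ[ k ] (x , y)) facets → InDilate k x y
      to (_ ∷ _ ∷ s ∷ r ∷ t ∷ []) = record
        { above-slant = subst (a * k ≤_) (⟦x+cy⟧ℕ a x y k) s
        ; below-right = subst (_≤ (2 * e + 6) * k) (⟦x+cy⟧ℕ 4 x y k) r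
        ; below-top   = subst (_≤ (3 * e + 6) * k) (⟦x+cy⟧ℕ (2 * e + 4) x y k) t
        }
      from : InDilate k x y → All (_∋ℕ[ k ] (x , y)) facets
      from in-kP = z≤n ∷ z≤n
                 ∷ subst (a * k ≤_) (sym (⟦x+cy⟧ℕ a x y k)) (above-slant in-kP)
                 ∷ subst (_≤ (2 * e + 6) * k) (sym (⟦x+cy⟧ℕ 4 x y k)) (below-right in-kP)
                 ∷ subst (_≤ (3 * e + 6) * k) (sym (⟦x+cy⟧ℕ (2 * e + 4) x y k)) (below-top in-kP)
                 ∷ []

    toPt : ℕ × ℕ → Pt
    toPt (x , y) = ℕ→ℚ x , ℕ→ℚ y

    doubled : Fin 5 → ℕ × ℕ
    doubled fz                     = 0 , 3
    doubled (fs fz)                = 0 , 2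
    doubled (fs (fs fz))           = 2 * a , 0
    doubled (fs (fs (fs fz)))      = 2 * (2 * e + 6) , 0
    doubled (fs (fs (fs (fs fz)))) = 2 * (2 * e + 4) , 1

    b+a≡2i+7 : 3 + d + a ≡ 2 * suc e + 7
    b+a≡2i+7 = trans (regroup a d) (trans (cong (3 +_) a+d≡) (unfold-i e))
      where
      regroup : ∀ a d → 3 + d + a ≡ 3 + (a + d)
      regroup = solve-∀
      unfold-i : ∀ e → 3 + (2 * e + 6) ≡ 2 * suc e + 7
      unfold-i = solve-∀

    vertex₂-x : (ℤ.+ (2 * suc e + 7)) ℤ.- (ℤ.+ (3 + d)) ≡ ℤ.+ a
    vertex₂-x = trans (ℤP.m-n≡m⊖n (2 * suc e + 7) (3 + d)) (trans (ℤP.⊖-≥ (subst (3 + d ≤_) b+a≡2i+7 (ℕP.m≤m+n (3 + d) a)))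
                       (cong ℤ.+_ (trans (cong (_∸ (3 + d)) (sym b+a≡2i+7)) (ℕP.m+n∸m≡n (3 + d) a))))

    2i+4≡ : 2 * suc e + 4 ≡ 2 * e + 6
    2i+4≡ = identity e
      where
      identity : ∀ e → 2 * suc e + 4 ≡ 2 * e + 6
      identity = solve-∀

    2i+2≡ : 2 * suc e + 2 ≡ 2 * e + 4
    2i+2≡ = identity e
      where
      identity : ∀ e → 2 * suc e + 2 ≡ 2 * e + 4
      identity = solve-∀

    twice-vertex : ∀ j → ℕ→ℚ 2 · pts V j ≡ toPt (doubled j)
    twice-vertex fz                     = refl
    twice-vertex (fs fz)                = refl
    twice-vertex (fs (fs fz))           = cong (_, 0ℚ) (trans (cong (λ z → ℕ→ℚ 2 ℚ.* ℤ→ℚ z) vertex₂-x) (sym (ℕ→ℚ-* 2 a)))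
    twice-vertex (fs (fs (fs fz)))      = cong (_, 0ℚ) (trans (sym (ℕ→ℚ-* 2 (2 * suc e + 4)))
                                                            (cong (λ n → ℕ→ℚ (2 * n)) 2i+4≡))
    twice-vertex (fs (fs (fs (fs fz)))) = cong (_, ℕ→ℚ 1) (trans (sym (ℕ→ℚ-* 2 (2 * suc e + 2)))
                                                            (cong (λ n → ℕ→ℚ (2 * n)) 2i+2≡))

    doubled∈2P : ∀ j → InDilate 2 (proj₁ (doubled j)) (proj₂ (doubled j))
    doubled∈2P fz = record
      { above-slant = ≤-offset a (s a)
      ; below-right = ≤-offset (4 * e) (r e)
      ; below-top   = ℕP.≤-reflexive (t e)
      }
      where
      s : ∀ a → a * 2 + a ≡ a * 3
      s = solve-∀
      r : ∀ e → 4 * 3 + 4 * e ≡ (2 * e + 6) * 2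
      r = solve-∀
      t : ∀ e → (2 * e + 4) * 3 ≡ (3 * e + 6) * 2
      t = solve-∀
    doubled∈2P (fs fz) = record
      { above-slant = ℕP.≤-refl
      ; below-right = ≤-offset (4 * e + 4) (r e)
      ; below-top   = ≤-offset (2 * e + 4) (t e)
      }
      where
      r : ∀ e → 4 * 2 + (4 * e + 4) ≡ (2 * e + 6) * 2
      r = solve-∀
      t : ∀ e → (2 * e + 4) * 2 + (2 * e + 4) ≡ (3 * e + 6) * 2
      t = solve-∀
    doubled∈2P (fs (fs fz)) = record
      { above-slant = ℕP.≤-reflexive (s a)
      ; below-right = ≤-offset (2 * d) (trans (r a d) (cong (_* 2) a+d≡))
      ; below-top   = ≤-offset (2 * d + 2 * e) (trans (t a d e) (trans (cong (λ n → n * 2 + 2 * e) a+d≡) (t′ e)))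
      }
      where
      s : ∀ a → a * 2 ≡ 2 * a + a * 0
      s = solve-∀
      r : ∀ a d → 2 * a + 4 * 0 + 2 * d ≡ (a + d) * 2
      r = solve-∀
      t : ∀ a d e → 2 * a + (2 * e + 4) * 0 + (2 * d + 2 * e) ≡ (a + d) * 2 + 2 * e
      t = solve-∀
      t′ : ∀ e → (2 * e + 6) * 2 + 2 * e ≡ (3 * e + 6) * 2
      t′ = solve-∀
    doubled∈2P (fs (fs (fs fz))) = record
      { above-slant = ≤-offset (2 * d) (trans (s a d) (cong (λ n → 2 * n + a * 0) a+d≡))
      ; below-right = ℕP.≤-reflexive (r e)
      ; below-top   = ≤-offset (2 * e) (t e)
      }
      where
      s : ∀ a d → a * 2 + 2 * d ≡ 2 * (a + d) + a * 0
      s = solve-∀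
      r : ∀ e → 2 * (2 * e + 6) + 4 * 0 ≡ (2 * e + 6) * 2
      r = solve-∀
      t : ∀ e → 2 * (2 * e + 6) + (2 * e + 4) * 0 + 2 * e ≡ (3 * e + 6) * 2
      t = solve-∀
    doubled∈2P (fs (fs (fs (fs fz)))) = record
      { above-slant = ≤-offset (d + 2 * e + 2) (trans (s a d e) (trans (cong (λ n → n + 2 * e + 2 + a) a+d≡) (s′ a e)))
      ; below-right = ℕP.≤-reflexive (r e)
      ; below-top   = ℕP.≤-reflexive (t e)
      }
      where
      s : ∀ a d e → a * 2 + (d + 2 * e + 2) ≡ (a + d) + 2 * e + 2 + a
      s = solve-∀
      s′ : ∀ a e → (2 * e + 6) + 2 * e + 2 + a ≡ 2 * (2 * e + 4) + a * 1
      s′ = solve-∀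
      r : ∀ e → 2 * (2 * e + 4) + 4 * 1 ≡ (2 * e + 6) * 2
      r = solve-∀
      t : ∀ e → 2 * (2 * e + 4) + (2 * e + 4) * 1 ≡ (3 * e + 6) * 2
      t = solve-∀

    vertex-in-facets : ∀ j → All (_∋ pts V j) facets
    vertex-in-facets j =
      All.map (λ {h} h∋2v → Equivalence.to (∋-dilate h (ℕ→ℚ 2) (ℕ→ℚ-pos 2) _ _)
                              (subst (h ∋[ ℕ→ℚ 2 ]_) (sym (twice-vertex j)) (Equivalence.from (∋-cast h 2 _ _) h∋2v)))
              (Equivalence.from (facets⇔InDilate 2 _ _) (doubled∈2P j))

    sound : ∀ {p} → p ∈conv V → All (_∋ p) facets
    sound = All∋-conv facets 5 (pts V) vertex-in-facets

module _ where
  open ℕ using (ℕ)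
  open ℚ using (ℚ; 0ℚ; 1ℚ; ½; _/_; _+_; _*_; _-_; -_; _≤_; _<_)

  module Triangulation (e a d : ℕ) (a+d≡ : a ℕ.+ d ≡ 2 ℕ.* e ℕ.+ 6) where
    open Polygon e a d a+d≡

    E A D : ℚ
    E = ℕ→ℚ e
    A = ℕ→ℚ a
    D = ℕ→ℚ d

    corner : Fin 5 → Pt
    corner fz                     = 0ℚ , ℤ.+ 3 / 2
    corner (fs fz)                = 0ℚ , 1ℚ
    corner (fs (fs fz))           = A , 0ℚ
    corner (fs (fs (fs fz)))      = ℕ→ℚ 2 * E + ℕ→ℚ 6 , 0ℚ
    corner (fs (fs (fs (fs fz)))) = ℕ→ℚ 2 * E + ℕ→ℚ 4 , ½

    vertex≡corner : ∀ j → pts V j ≡ corner j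
    vertex≡corner fz                     = refl
    vertex≡corner (fs fz)                = refl
    vertex≡corner (fs (fs fz))           = cong (λ z → ℤ→ℚ z , 0ℚ) vertex₂-x
    vertex≡corner (fs (fs (fs fz)))      = cong (_, 0ℚ) (trans (cong ℕ→ℚ 2i+4≡) (ℕ→ℚ-affine 2 e 6))
    vertex≡corner (fs (fs (fs (fs fz)))) = cong (_, ½) (trans (cong ℕ→ℚ 2i+2≡) (ℕ→ℚ-affine 2 e 4))

    record InP (x y : ℚ) : Set where
      field
        x≥0         : 0ℚ ≤ x
        y≥0         : 0ℚ ≤ y
        slant-slack : 0ℚ ≤ x + A * y - A
        right-slack : 0ℚ ≤ ℕ→ℚ 2 * E + ℕ→ℚ 6 - x - ℕ→ℚ 4 * y
        top-slack   : 0ℚ ≤ ℕ→ℚ 3 * E + ℕ→ℚ 6 - x - (ℕ→ℚ 2 * E + ℕ→ℚ 4) * y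
    open InP

    facets⇒InP : ∀ {x y} → All (_∋ (x , y)) facets → InP x y
    facets⇒InP {x} {y} (l ∷ b ∷ s ∷ r ∷ t ∷ []) = record
      { x≥0         = slack l (left-slack x y)
      ; y≥0         = slack b (bottom-slack x y)
      ; slant-slack = slack s (slant-slack′ A x y)
      ; right-slack = slack r (trans (right-slack′ (ℕ→ℚ (2 ℕ.* e ℕ.+ 6)) x y) (cong (λ c → c - x - ℕ→ℚ 4 * y) (ℕ→ℚ-affine 2 e 6)))
      ; top-slack   = slack t (trans (top-slack′ (ℕ→ℚ (3 ℕ.* e ℕ.+ 6)) (ℕ→ℚ (2 ℕ.* e ℕ.+ 4)) x y)
                                     (cong₂ (λ c c′ → c - x - c′ * y) (ℕ→ℚ-affine 3 e 6) (ℕ→ℚ-affine 2 e 4)))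
      }
      where
      slack : ∀ {p q s} → p ≤ q → q - p ≡ s → 0ℚ ≤ s
      slack p≤q q-p≡s = subst (0ℚ ≤_) q-p≡s (p≤q⇒0≤q-p p≤q)
      left-slack : ∀ x y → ℕ→ℚ 1 * x + ℕ→ℚ 0 * y + ℕ→ℚ 0 * 1ℚ - (ℕ→ℚ 0 * x + ℕ→ℚ 0 * y + ℕ→ℚ 0 * 1ℚ) ≡ x
      left-slack = ring-solve-∀ ℚ-ring
      bottom-slack : ∀ x y → ℕ→ℚ 0 * x + ℕ→ℚ 1 * y + ℕ→ℚ 0 * 1ℚ - (ℕ→ℚ 0 * x + ℕ→ℚ 0 * y + ℕ→ℚ 0 * 1ℚ) ≡ y
      bottom-slack = ring-solve-∀ ℚ-ring
      slant-slack′ : ∀ A x y → ℕ→ℚ 1 * x + A * y + ℕ→ℚ 0 * 1ℚ - (ℕ→ℚ 0 * x + ℕ→ℚ 0 * y + A * 1ℚ) ≡ x + A * y - A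
      slant-slack′ = ring-solve-∀ ℚ-ring
      right-slack′ : ∀ C x y → ℕ→ℚ 0 * x + ℕ→ℚ 0 * y + C * 1ℚ - (ℕ→ℚ 1 * x + ℕ→ℚ 4 * y + ℕ→ℚ 0 * 1ℚ)
                               ≡ C - x - ℕ→ℚ 4 * y
      right-slack′ = ring-solve-∀ ℚ-ring
      top-slack′ : ∀ C B x y → ℕ→ℚ 0 * x + ℕ→ℚ 0 * y + C * 1ℚ - (ℕ→ℚ 1 * x + B * y + ℕ→ℚ 0 * 1ℚ)
                               ≡ C - x - B * y
      top-slack′ = ring-solve-∀ ℚ-ring

    ∈conv-corners : ∀ {x y} c₀ c₁ c₂ c₃ c₄ → 0ℚ ≤ c₀ → 0ℚ ≤ c₁ → 0ℚ ≤ c₂ → 0ℚ ≤ c₃ → 0ℚ ≤ c₄ →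
      c₀ + c₁ + c₂ + c₃ + c₄ ≡ 1ℚ →
      c₂ * A + c₃ * (ℕ→ℚ 2 * E + ℕ→ℚ 6) + c₄ * (ℕ→ℚ 2 * E + ℕ→ℚ 4) ≡ x →
      c₀ * (ℤ.+ 3 / 2) + c₁ + c₄ * ½ ≡ y →
      (x , y) ∈conv V
    ∈conv-corners c₀ c₁ c₂ c₃ c₄ 0≤c₀ 0≤c₁ 0≤c₂ 0≤c₃ 0≤c₄ ∑c≡1 ∑cx≡x ∑cy≡y =
      ∈conv-cong 5 (sym ∘ vertex≡corner)
        ( c , 0≤c
        , trans (sum-shape c₀ c₁ c₂ c₃ c₄) ∑c≡1
        , trans (x-shape c₀ c₁ c₂ c₃ c₄ A (ℕ→ℚ 2 * E + ℕ→ℚ 6) (ℕ→ℚ 2 * E + ℕ→ℚ 4)) ∑cx≡x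
        , trans (y-shape c₀ c₁ c₂ c₃ c₄) ∑cy≡y )
      where
      c : Fin 5 → ℚ
      c fz                     = c₀
      c (fs fz)                = c₁
      c (fs (fs fz))           = c₂
      c (fs (fs (fs fz)))      = c₃
      c (fs (fs (fs (fs fz)))) = c₄
      0≤c : ∀ j → 0ℚ ≤ c j
      0≤c fz                     = 0≤c₀
      0≤c (fs fz)                = 0≤c₁
      0≤c (fs (fs fz))           = 0≤c₂
      0≤c (fs (fs (fs fz)))      = 0≤c₃
      0≤c (fs (fs (fs (fs fz)))) = 0≤c₄
      sum-shape : ∀ c₀ c₁ c₂ c₃ c₄ → c₀ + (c₁ + (c₂ + (c₃ + (c₄ + 0ℚ)))) ≡ c₀ + c₁ + c₂ + c₃ + c₄
      sum-shape = ring-solve-∀ ℚ-ring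
      x-shape : ∀ c₀ c₁ c₂ c₃ c₄ x₂ x₃ x₄ →
        c₀ * 0ℚ + (c₁ * 0ℚ + (c₂ * x₂ + (c₃ * x₃ + (c₄ * x₄ + 0ℚ)))) ≡ c₂ * x₂ + c₃ * x₃ + c₄ * x₄
      x-shape = ring-solve-∀ ℚ-ring
      y-shape : ∀ c₀ c₁ c₂ c₃ c₄ →
        c₀ * (ℤ.+ 3 / 2) + (c₁ * 1ℚ + (c₂ * 0ℚ + (c₃ * 0ℚ + (c₄ * ½ + 0ℚ))))
          ≡ c₀ * (ℤ.+ 3 / 2) + c₁ + c₄ * ½
      y-shape = ring-solve-∀ ℚ-ring

    -- With vⱼ = corner j, the diagonals v₁v₄ and v₁v₃ (where side₁₄ resp. side₁₃ vanishes) cut P into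
    -- the triangles v₀v₁v₄, v₁v₃v₄ and v₁v₂v₃; each weight below is a barycentric coordinate.
    side₁₄ side₁₃ : ℚ → ℚ → ℚ
    side₁₄ x y = x + (ℕ→ℚ 4 * E + ℕ→ℚ 8) * (y - 1ℚ)
    side₁₃ x y = x + (ℕ→ℚ 2 * E + ℕ→ℚ 6) * (y - 1ℚ)

    0≤E : 0ℚ ≤ E
    0≤E = ℕ→ℚ-nonNeg e

    2E+c>0 : ∀ c .{{_ : ℕ.NonZero c}} → 0ℚ < ℕ→ℚ 2 * E + ℕ→ℚ c
    2E+c>0 c = ℚP.+-mono-≤-< (nonNeg* (ℕ→ℚ-nonNeg 2) 0≤E) (ℕ→ℚ-pos c)

    rescaled : ∀ F K {w z} → F * K ≡ 1ℚ → w ≡ (F * K) * z → w ≡ z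
    rescaled F K {z = z} FK≡1 w≡ = trans w≡ (trans (cong (_* z) FK≡1) (ℚP.*-identityˡ z))

    in-triangle-v₀v₁v₄ : ∀ {x y} → InP x y → 0ℚ ≤ side₁₄ x y → (x , y) ∈conv V
    in-triangle-v₀v₁v₄ {x} {y} in-P 0≤s =
      ∈conv-corners (K * side₁₄ x y) (ℕ→ℚ 2 * K * T) 0ℚ 0ℚ (K * x)
        (nonNeg* 0≤K 0≤s) (nonNeg* (nonNeg* (ℕ→ℚ-nonNeg 2) 0≤K) (top-slack in-P)) ℚP.≤-refl ℚP.≤-refl
        (nonNeg* 0≤K (x≥0 in-P))
        (rescaled Q K QK≡1 (sum K E x y)) (rescaled Q K QK≡1 (x-coord K A E x)) (rescaled Q K QK≡1 (y-coord K E x y))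
      where
      Q K T : ℚ
      Q = ℕ→ℚ 2 * E + ℕ→ℚ 4
      K = recip Q (2E+c>0 4)
      T = ℕ→ℚ 3 * E + ℕ→ℚ 6 - x - (ℕ→ℚ 2 * E + ℕ→ℚ 4) * y
      0≤K : 0ℚ ≤ K
      0≤K = ℚP.<⇒≤ (recip-pos Q (2E+c>0 4))
      QK≡1 : Q * K ≡ 1ℚ
      QK≡1 = *-recip Q (2E+c>0 4)
      sum : ∀ K E x y →
        K * (x + (ℕ→ℚ 4 * E + ℕ→ℚ 8) * (y - 1ℚ)) + ℕ→ℚ 2 * K * (ℕ→ℚ 3 * E + ℕ→ℚ 6 - x - (ℕ→ℚ 2 * E + ℕ→ℚ 4) * y)
          + 0ℚ + 0ℚ + K * x ≡ ((ℕ→ℚ 2 * E + ℕ→ℚ 4) * K) * 1ℚ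
      sum = ring-solve-∀ ℚ-ring
      x-coord : ∀ K A E x → 0ℚ * A + 0ℚ * (ℕ→ℚ 2 * E + ℕ→ℚ 6) + K * x * (ℕ→ℚ 2 * E + ℕ→ℚ 4)
                            ≡ ((ℕ→ℚ 2 * E + ℕ→ℚ 4) * K) * x
      x-coord = ring-solve-∀ ℚ-ring
      y-coord : ∀ K E x y →
        K * (x + (ℕ→ℚ 4 * E + ℕ→ℚ 8) * (y - 1ℚ)) * (ℤ.+ 3 / 2)
          + ℕ→ℚ 2 * K * (ℕ→ℚ 3 * E + ℕ→ℚ 6 - x - (ℕ→ℚ 2 * E + ℕ→ℚ 4) * y) + K * x * ½
          ≡ ((ℕ→ℚ 2 * E + ℕ→ℚ 4) * K) * y
      y-coord = ring-solve-∀ ℚ-ring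

    in-triangle-v₁v₃v₄ : ∀ {x y} → InP x y → side₁₄ x y ≤ 0ℚ → 0ℚ ≤ side₁₃ x y → (x , y) ∈conv V
    in-triangle-v₁v₃v₄ {x} {y} in-P s₁≤0 0≤s₂ =
      ∈conv-corners 0ℚ (K * Rs) 0ℚ (K * (- side₁₄ x y)) (ℕ→ℚ 2 * K * side₁₃ x y)
        ℚP.≤-refl (nonNeg* 0≤K (right-slack in-P)) ℚP.≤-refl (nonNeg* 0≤K (ℚP.neg-antimono-≤ s₁≤0))
        (nonNeg* (nonNeg* (ℕ→ℚ-nonNeg 2) 0≤K) 0≤s₂)
        (rescaled F K FK≡1 (sum K E x y)) (rescaled F K FK≡1 (x-coord K A E x y)) (rescaled F K FK≡1 (y-coord K E x y))
      where
      F K Rs : ℚ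
      F = ℕ→ℚ 2 * E + ℕ→ℚ 2
      K = recip F (2E+c>0 2)
      Rs = ℕ→ℚ 2 * E + ℕ→ℚ 6 - x - ℕ→ℚ 4 * y
      0≤K : 0ℚ ≤ K
      0≤K = ℚP.<⇒≤ (recip-pos F (2E+c>0 2))
      FK≡1 : F * K ≡ 1ℚ
      FK≡1 = *-recip F (2E+c>0 2)
      sum : ∀ K E x y →
        0ℚ + K * (ℕ→ℚ 2 * E + ℕ→ℚ 6 - x - ℕ→ℚ 4 * y) + 0ℚ + K * (- (x + (ℕ→ℚ 4 * E + ℕ→ℚ 8) * (y - 1ℚ)))
          + ℕ→ℚ 2 * K * (x + (ℕ→ℚ 2 * E + ℕ→ℚ 6) * (y - 1ℚ)) ≡ ((ℕ→ℚ 2 * E + ℕ→ℚ 2) * K) * 1ℚ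
      sum = ring-solve-∀ ℚ-ring
      x-coord : ∀ K A E x y →
        0ℚ * A + K * (- (x + (ℕ→ℚ 4 * E + ℕ→ℚ 8) * (y - 1ℚ))) * (ℕ→ℚ 2 * E + ℕ→ℚ 6)
          + ℕ→ℚ 2 * K * (x + (ℕ→ℚ 2 * E + ℕ→ℚ 6) * (y - 1ℚ)) * (ℕ→ℚ 2 * E + ℕ→ℚ 4)
          ≡ ((ℕ→ℚ 2 * E + ℕ→ℚ 2) * K) * x
      x-coord = ring-solve-∀ ℚ-ring
      y-coord : ∀ K E x y →
        0ℚ * (ℤ.+ 3 / 2) + K * (ℕ→ℚ 2 * E + ℕ→ℚ 6 - x - ℕ→ℚ 4 * y)
          + ℕ→ℚ 2 * K * (x + (ℕ→ℚ 2 * E + ℕ→ℚ 6) * (y - 1ℚ)) * ½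
          ≡ ((ℕ→ℚ 2 * E + ℕ→ℚ 2) * K) * y
      y-coord = ring-solve-∀ ℚ-ring

    R≡A+D : ℕ→ℚ 2 * E + ℕ→ℚ 6 ≡ A + D
    R≡A+D = trans (sym (ℕ→ℚ-affine 2 e 6)) (trans (cong ℕ→ℚ (sym a+d≡)) (ℕ→ℚ-+ a d))

    -- D = b − 3 vanishes when v₂ = v₃, but then no point of P has side₁₃ < 0.
    in-triangle-v₁v₂v₃ : ∀ {x y} → InP x y → side₁₃ x y < 0ℚ → (x , y) ∈conv V
    in-triangle-v₁v₂v₃ {x} {y} in-P s₂<0 =
      ∈conv-corners 0ℚ y (K * (- side₁₃ x y)) (K * Ss) 0ℚ
        ℚP.≤-refl (y≥0 in-P) (nonNeg* 0≤K (ℚP.neg-antimono-≤ (ℚP.<⇒≤ s₂<0))) (nonNeg* 0≤K (slant-slack in-P))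
        ℚP.≤-refl
        (trans (cong (λ r → 0ℚ + y + K * (- (x + r * (y - 1ℚ))) + K * Ss + 0ℚ) R≡A+D)
               (trans (sum K A D x y) (trans (cong (λ t → t * (1ℚ - y) + y) DK≡1) (complement y))))
        (trans (cong (λ r → K * (- (x + r * (y - 1ℚ))) * A + K * Ss * r + 0ℚ * (ℕ→ℚ 2 * E + ℕ→ℚ 4)) R≡A+D)
               (rescaled D K DK≡1 (x-coord K A D E x y)))
        (y-coord y)
      where
      Ss : ℚ
      Ss = x + A * y - A
      Ss≡ : Ss ≡ side₁₃ x y + D * (1ℚ - y)
      Ss≡ = trans (slant-split A D x y) (cong (λ r → x + r * (y - 1ℚ) + D * (1ℚ - y)) (sym R≡A+D))
        where
        slant-split : ∀ A D x y → x + A * y - A ≡ x + (A + D) * (y - 1ℚ) + D * (1ℚ - y)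
        slant-split = ring-solve-∀ ℚ-ring
      0<D : 0ℚ < D
      0<D with ℚP.<-cmp 0ℚ D
      ... | tri< 0<D _ _ = 0<D
      ... | tri≈ _ 0≡D _ = ⊥-elim (ℚP.<-irrefl refl (ℚP.<-≤-trans s₂<0 (subst (0ℚ ≤_) Ss≡0 (slant-slack in-P))))
        where
        Ss≡0 : Ss ≡ side₁₃ x y
        Ss≡0 = trans Ss≡ (trans (cong (λ t → side₁₃ x y + t * (1ℚ - y)) (sym 0≡D))
                                (trans (cong (side₁₃ x y +_) (ℚP.*-zeroˡ (1ℚ - y))) (ℚP.+-identityʳ _)))
      ... | tri> _ _ D<0 = ⊥-elim (ℚP.<-irrefl refl (ℚP.<-≤-trans D<0 (ℕ→ℚ-nonNeg d)))
      K : ℚ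
      K = recip D 0<D
      0≤K : 0ℚ ≤ K
      0≤K = ℚP.<⇒≤ (recip-pos D 0<D)
      DK≡1 : D * K ≡ 1ℚ
      DK≡1 = *-recip D 0<D
      sum : ∀ K A D x y → 0ℚ + y + K * (- (x + (A + D) * (y - 1ℚ))) + K * (x + A * y - A) + 0ℚ
                          ≡ (D * K) * (1ℚ - y) + y
      sum = ring-solve-∀ ℚ-ring
      complement : ∀ y → 1ℚ * (1ℚ - y) + y ≡ 1ℚ
      complement = ring-solve-∀ ℚ-ring
      x-coord : ∀ K A D E x y → K * (- (x + (A + D) * (y - 1ℚ))) * A + K * (x + A * y - A) * (A + D)
                                  + 0ℚ * (ℕ→ℚ 2 * E + ℕ→ℚ 4) ≡ (D * K) * x
      x-coord = ring-solve-∀ ℚ-ring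
      y-coord : ∀ y → 0ℚ * (ℤ.+ 3 / 2) + y + 0ℚ * ½ ≡ y
      y-coord = ring-solve-∀ ℚ-ring

    InP⇒∈conv : ∀ {x y} → InP x y → (x , y) ∈conv V
    InP⇒∈conv {x} {y} in-P with 0ℚ ℚP.≤? side₁₄ x y | 0ℚ ℚP.≤? side₁₃ x y
    ... | yes 0≤s₁ | _        = in-triangle-v₀v₁v₄ in-P 0≤s₁
    ... | no  0≰s₁ | yes 0≤s₂ = in-triangle-v₁v₃v₄ in-P (ℚP.<⇒≤ (ℚP.≰⇒> 0≰s₁)) 0≤s₂
    ... | no  _    | no  0≰s₂ = in-triangle-v₁v₂v₃ in-P (ℚP.≰⇒> 0≰s₂)

    complete : ∀ {p} → All (_∋ p) facets → p ∈conv V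
    complete = InP⇒∈conv ∘ facets⇒InP

-- Lattice points of the dilates

module _ where
  open ℕ using (ℕ; suc; _+_; _*_; _∸_; _≤_; _<_; _⊓_; z≤n; s≤s; NonZero)
  open ℤ using (ℤ)
  open ℚ using (ℚ; 0ℚ)

  module Counting (e a d : ℕ) (a+d≡ : a + d ≡ 2 * e + 6) (k : ℕ) where
    open Polygon e a d a+d≡
    open InDilate

    P′ Q′ : ℕ
    P′ = (2 * e + 6) * k
    Q′ = (3 * e + 6) * k

    lo hi len : ℕ → ℕ
    lo y  = a * (k ∸ y)
    hi y  = (P′ ∸ 4 * y) ⊓ (Q′ ∸ (2 * e + 4) * y)
    len y = suc (hi y) ∸ lo y

    top-coefficient⇔ : ∀ y → (2 * e + 4) * y ≤ Q′ ⇔ 2 * y ≤ 3 * k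
    top-coefficient⇔ y = mk⇔
      (λ le → ℕP.*-cancelˡ-≤ (2 + e) (subst₂ _≤_ (lhs e y) (rhs e k) le))
      (λ le → subst₂ _≤_ (sym (lhs e y)) (sym (rhs e k)) (ℕP.*-monoʳ-≤ (2 + e) le))
      where
      lhs : ∀ e y → (2 * e + 4) * y ≡ (2 + e) * (2 * y)
      lhs = solve-∀
      rhs : ∀ e k → (3 * e + 6) * k ≡ (2 + e) * (3 * k)
      rhs = solve-∀

    4y≤P′ : ∀ y → 2 * y ≤ 3 * k → 4 * y ≤ P′
    4y≤P′ y 2y≤3k = begin
      4 * y            ≡⟨ double y ⟩
      2 * (2 * y)      ≤⟨ ℕP.*-monoʳ-≤ 2 2y≤3k ⟩
      2 * (3 * k)      ≤⟨ ≤-offset (2 * e * k) (widen e k) ⟩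
      (2 * e + 6) * k  ∎
      where
      open ℕP.≤-Reasoning
      double : ∀ y → 4 * y ≡ 2 * (2 * y)
      double = solve-∀
      widen : ∀ e k → 2 * (3 * k) + 2 * e * k ≡ (2 * e + 6) * k
      widen = solve-∀

    InDilate⇔row : ∀ x y → InDilate k x y ⇔ (2 * y ≤ 3 * k × lo y ≤ x × x ≤ hi y)
    InDilate⇔row x y = mk⇔ to from
      where
      to : InDilate k x y → 2 * y ≤ 3 * k × lo y ≤ x × x ≤ hi y
      to in-kP =
        Equivalence.to (top-coefficient⇔ y) (proj₁ under-top) ,
        Equivalence.to (≤+*⇔*∸≤ a k x y) (above-slant in-kP) ,
        ℕP.⊓-glb (proj₂ (Equivalence.to (+≤⇔≤∸ x (4 * y) P′) (below-right in-kP))) (proj₂ under-top)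
        where
        under-top : (2 * e + 4) * y ≤ Q′ × x ≤ Q′ ∸ (2 * e + 4) * y
        under-top = Equivalence.to (+≤⇔≤∸ x ((2 * e + 4) * y) Q′) (below-top in-kP)
      from : 2 * y ≤ 3 * k × lo y ≤ x × x ≤ hi y → InDilate k x y
      from (2y≤3k , lo≤x , x≤hi) = record
        { above-slant = Equivalence.from (≤+*⇔*∸≤ a k x y) lo≤x
        ; below-right = Equivalence.from (+≤⇔≤∸ x (4 * y) P′)
                          (4y≤P′ y 2y≤3k , ℕP.≤-trans x≤hi (ℕP.m⊓n≤m _ _))
        ; below-top   = Equivalence.from (+≤⇔≤∸ x ((2 * e + 4) * y) Q′)
                          (Equivalence.from (top-coefficient⇔ y) 2y≤3k , ℕP.≤-trans x≤hi (ℕP.m⊓n≤n _ _))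
        }


    a≤2e+6 : a ≤ 2 * e + 6
    a≤2e+6 = subst (a ≤_) a+d≡ (ℕP.m≤m+n a d)

    lo≤hi : ∀ y → 2 * y ≤ 3 * k → lo y ≤ hi y
    lo≤hi y 2y≤3k with ℕP.≤-total y k
    ... | inj₁ y≤k = ℕP.⊓-glb
            (ℕP.m+n≤o⇒m≤o∸n (lo y) (mixture-bound {c₂ = 4} {C = 2 * e + 6} a≤2e+6 (≤-offset (2 * e + 2) (four e)) y≤k))
            (ℕP.m+n≤o⇒m≤o∸n (lo y) (mixture-bound {c₂ = 2 * e + 4} {C = 3 * e + 6} (ℕP.≤-trans a≤2e+6 (≤-offset e (widen e))) (≤-offset (e + 2) (grow e)) y≤k))
      where
      four : ∀ e → 4 + (2 * e + 2) ≡ 2 * e + 6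
      four = solve-∀
      widen : ∀ e → 2 * e + 6 + e ≡ 3 * e + 6
      widen = solve-∀
      grow : ∀ e → 2 * e + 4 + (e + 2) ≡ 3 * e + 6
      grow = solve-∀
    ... | inj₂ k≤y = subst (_≤ hi y) (sym (trans (cong (a *_) (ℕP.m≤n⇒m∸n≡0 k≤y)) (ℕP.*-zeroʳ a))) z≤n

    -- Below the vertex k·v₄, at height k/2, the right edge bounds the rows; above it the top edge does.
    hi-lower : ∀ y → 2 * y ≤ k → hi y ≡ P′ ∸ 4 * y
    hi-lower y 2y≤k = ℕP.m≤n⇒m⊓n≡m (ℕP.m+n≤o⇒m≤o∸n (P′ ∸ 4 * y) (begin
      (P′ ∸ 4 * y) + (2 * e + 4) * y     ≡⟨ split (P′ ∸ 4 * y) e y ⟩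
      (P′ ∸ 4 * y) + 4 * y + e * (2 * y) ≡⟨ cong (_+ e * (2 * y)) (ℕP.m∸n+n≡m (4y≤P′ y 2y≤3k)) ⟩
      P′ + e * (2 * y)                   ≤⟨ ℕP.+-monoʳ-≤ P′ (ℕP.*-monoʳ-≤ e 2y≤k) ⟩
      P′ + e * k                         ≡⟨ merge e k ⟩
      Q′                                 ∎))
      where
      open ℕP.≤-Reasoning
      2y≤3k : 2 * y ≤ 3 * k
      2y≤3k = ℕP.≤-trans 2y≤k (ℕP.m≤n*m k 3)
      split : ∀ u e y → u + (2 * e + 4) * y ≡ u + 4 * y + e * (2 * y)
      split = solve-∀
      merge : ∀ e k → (2 * e + 6) * k + e * k ≡ (3 * e + 6) * k
      merge = solve-∀

    hi-upper : ∀ y → k ≤ 2 * y → 2 * y ≤ 3 * k → hi y ≡ Q′ ∸ (2 * e + 4) * y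
    hi-upper y k≤2y 2y≤3k = ℕP.m≥n⇒m⊓n≡n (ℕP.m+n≤o⇒m≤o∸n (Q′ ∸ (2 * e + 4) * y)
      (ℕP.+-cancelʳ-≤ (e * (2 * y)) _ _ (begin
        (Q′ ∸ (2 * e + 4) * y) + 4 * y + e * (2 * y) ≡⟨ regroup (Q′ ∸ (2 * e + 4) * y) e y ⟩
        (Q′ ∸ (2 * e + 4) * y) + (2 * e + 4) * y     ≡⟨ ℕP.m∸n+n≡m (Equivalence.from (top-coefficient⇔ y) 2y≤3k) ⟩
        Q′                                           ≡⟨ split e k ⟩
        P′ + e * k                                   ≤⟨ ℕP.+-monoʳ-≤ P′ (ℕP.*-monoʳ-≤ e k≤2y) ⟩
        P′ + e * (2 * y)                             ∎)))
      where
      open ℕP.≤-Reasoning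
      regroup : ∀ u e y → u + 4 * y + e * (2 * y) ≡ u + (2 * e + 4) * y
      regroup = solve-∀
      split : ∀ e k → (3 * e + 6) * k ≡ (2 * e + 6) * k + e * k
      split = solve-∀

  module LatticePoints (e a d : ℕ) (a+d≡ : a + d ≡ 2 * e + 6) where
    open Polygon e a d a+d≡
    open Triangulation e a d a+d≡ using (complete)
    open HDescription V facets sound complete public

    LatticePoint : ℕ → ℤ × ℤ → Set
    LatticePoint k z = ∃₂ λ x y → z ≡ (ℤ.+ x , ℤ.+ y) × InDilate k x y

    lattice-points⇔ : ∀ k .{{_ : NonZero k}} z → ℤ²→Pt z ∈dil k · V ⇔ LatticePoint k z
    lattice-points⇔ k (zx , zy) = mk⇔ to from
      where
      natural : ∀ z → 0ℚ ℚ.≤ ℤ→ℚ z → ∃ λ n → z ≡ ℤ.+ n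
      natural (ℤ.+ n)    _   = n , refl
      natural ℤ.-[1+ n ] 0≤z with ℤ→ℚ-cancel-≤ {ℤ.+ 0} {ℤ.-[1+ n ]} 0≤z
      ... | ()
      origin-form : ∀ X Y K → ℕ→ℚ 0 ℚ.* X ℚ.+ ℕ→ℚ 0 ℚ.* Y ℚ.+ ℕ→ℚ 0 ℚ.* K ≡ 0ℚ
      origin-form = ring-solve-∀ ℚ-ring
      x-form : ∀ X Y K → ℕ→ℚ 1 ℚ.* X ℚ.+ ℕ→ℚ 0 ℚ.* Y ℚ.+ ℕ→ℚ 0 ℚ.* K ≡ X
      x-form = ring-solve-∀ ℚ-ring
      y-form : ∀ X Y K → ℕ→ℚ 0 ℚ.* X ℚ.+ ℕ→ℚ 1 ℚ.* Y ℚ.+ ℕ→ℚ 0 ℚ.* K ≡ Y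
      y-form = ring-solve-∀ ℚ-ring
      to : ℤ²→Pt (zx , zy) ∈dil k · V → LatticePoint k (zx , zy)
      to z∈ = lift (natural zx (subst₂ ℚ._≤_ (origin-form X Y K) (x-form X Y K) x≥0))
                   (natural zy (subst₂ ℚ._≤_ (origin-form X Y K) (y-form X Y K) y≥0))
        where
        X Y K : ℚ
        X = ℤ→ℚ zx
        Y = ℤ→ℚ zy
        K = ℕ→ℚ k
        facets-hold : All (_∋[ K ] (X , Y)) facets
        facets-hold = Equivalence.to (∈dil⇔ k X Y) z∈
        x≥0 : left ∋[ K ] (X , Y)
        x≥0 = All.head facets-hold
        y≥0 : bottom ∋[ K ] (X , Y)
        y≥0 = All.head (All.tail facets-hold)
        lift : (∃ λ x → zx ≡ ℤ.+ x) → (∃ λ y → zy ≡ ℤ.+ y) → LatticePoint k (zx , zy)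
        lift (x , refl) (y , refl) =
          x , y , refl , Equivalence.to (facets⇔InDilate k x y) (Equivalence.to (lattice∈dil⇔ k x y) z∈)
      from : LatticePoint k (zx , zy) → ℤ²→Pt (zx , zy) ∈dil k · V
      from (x , y , refl , in-kP) = Equivalence.from (lattice∈dil⇔ k x y) (Equivalence.from (facets⇔InDilate k x y) in-kP)

  module LatticeCount (e a d : ℕ) (a+d≡ : a + d ≡ 2 * e + 6) (t r : ℕ) (r≤1 : r ≤ 1)
                      .{{_ : NonZero (2 * t + r)}} where

    -- Rows 0 … t lie below k·v₄ and rows t + 1 … 3t + r above it; Y = ⌊3k/2⌋ is the top row.
    k : ℕ
    k = 2 * t + r

    open Polygon e a d a+d≡
    open Counting e a d a+d≡ k
    open LatticePoints e a d a+d≡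

    Y : ℕ
    Y = 3 * t + r

    rows⇔ : ∀ y → 2 * y ≤ 3 * k ⇔ y ≤ Y
    rows⇔ y = mk⇔ to from
      where
      3k≡ : ∀ t r → 3 * (2 * t + r) ≡ 2 * (3 * t + r) + r
      3k≡ = solve-∀
      from : y ≤ Y → 2 * y ≤ 3 * k
      from y≤Y = subst (2 * y ≤_) (sym (3k≡ t r)) (ℕP.≤-trans (ℕP.*-monoʳ-≤ 2 y≤Y) (ℕP.m≤m+n (2 * Y) r))
      to : 2 * y ≤ 3 * k → y ≤ Y
      to 2y≤3k with y ℕ.≤? Y
      ... | yes y≤Y = y≤Y
      ... | no  y≰Y = ⊥-elim (ℕP.<⇒≱ (s≤s r≤1) (ℕP.+-cancelˡ-≤ (2 * Y) 2 r (begin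
        2 * Y + 2    ≡⟨ ℕP.+-comm (2 * Y) 2 ⟩
        2 + 2 * Y    ≡⟨ sym (ℕP.*-suc 2 Y) ⟩
        2 * suc Y    ≤⟨ ℕP.*-monoʳ-≤ 2 (ℕP.≰⇒> y≰Y) ⟩
        2 * y        ≤⟨ 2y≤3k ⟩
        3 * k        ≡⟨ 3k≡ t r ⟩
        2 * Y + r    ∎)))
        where open ℕP.≤-Reasoning

    lattice⇔stack : ∀ z → LatticePoint k z ⇔ Stack (suc Y) lo len z
    lattice⇔stack z = mk⇔ to from
      where
      on-row : ∀ {x y} → 2 * y ≤ 3 * k × lo y ≤ x × x ≤ hi y → Stack (suc Y) lo len (ℤ.+ x , ℤ.+ y)
      on-row {x} {y} (2y≤3k , lo≤x , x≤hi) =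
        y , s≤s (Equivalence.to (rows⇔ y) 2y≤3k) , x ∸ lo y , segment-index lo≤x x≤hi ,
        cong (λ u → ℤ.+ u , ℤ.+ y) (sym (ℕP.m+[n∸m]≡n lo≤x))
      to : LatticePoint k z → Stack (suc Y) lo len z
      to (x , y , refl , in-kP) = on-row (Equivalence.to (InDilate⇔row x y) in-kP)
      from : Stack (suc Y) lo len z → LatticePoint k z
      from (y , y<1+Y , j , j<len , refl) =
        lo y + j , y , refl ,
        Equivalence.from (InDilate⇔row (lo y + j) y)
          (Equivalence.from (rows⇔ y) (ℕP.≤-pred y<1+Y) , ℕP.m≤m+n (lo y) j , segment-bound j<len)

    HasCard-dilate : HasCard (λ z → ℤ²→Pt z ∈dil k · V) (∑ℕ (suc Y) len)
    HasCard-dilate = HasCard-cong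
      (λ z z∈ → Equivalence.from (lattice-points⇔ k z) (Equivalence.from (lattice⇔stack z) z∈))
      (λ z z∈ → Equivalence.to (lattice⇔stack z) (Equivalence.to (lattice-points⇔ k z) z∈))
      (HasCard-stack (suc Y) lo len)

    lower-row : ∀ y → y < suc t → 2 * y ≤ k
    lower-row y y<1+t = ℕP.≤-trans (ℕP.*-monoʳ-≤ 2 (ℕP.≤-pred y<1+t)) (ℕP.m≤m+n (2 * t) r)

    upper-row : ∀ j → j < k → k ≤ 2 * (suc t + j) × 2 * (suc t + j) ≤ 3 * k
    upper-row j j<k =
      ℕP.≤-trans (ℕP.+-monoʳ-≤ (2 * t) r≤1) (≤-offset (1 + 2 * j) (above t j)) ,
      Equivalence.from (rows⇔ (suc t + j)) (subst (_≤ Y) (ℕP.+-suc t j) (subst (t + suc j ≤_) (sum t r) (ℕP.+-monoʳ-≤ t j<k)))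
      where
      above : ∀ t j → 2 * t + 1 + (1 + 2 * j) ≡ 2 * (suc t + j)
      above = solve-∀
      sum : ∀ t r → t + (2 * t + r) ≡ 3 * t + r
      sum = solve-∀

    2∑lo : 2 * ∑ℕ (suc Y) lo ≡ a * (k * k + k)
    2∑lo = begin
      2 * ∑ℕ (suc Y) lo                                          ≡⟨ cong (λ n → 2 * ∑ℕ n lo) (rows-split t r) ⟩
      2 * ∑ℕ (suc k + t) lo                                      ≡⟨ cong (2 *_) (∑ℕ-split (suc k) t lo) ⟩
      2 * (∑ℕ (suc k) lo + ∑ℕ t (λ j → lo (suc k + j)))          ≡⟨ cong (λ s → 2 * (∑ℕ (suc k) lo + s)) vanishing ⟩
      2 * (∑ℕ (suc k) lo + 0)                                    ≡⟨ cong (λ s → 2 * s) (trans (ℕP.+-identityʳ _) (∑ℕ-*ˡ (suc k) a (k ∸_))) ⟩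
      2 * (a * ∑ℕ (suc k) (k ∸_))                                ≡⟨ swap a (∑ℕ (suc k) (k ∸_)) ⟩
      a * (2 * ∑ℕ (suc k) (k ∸_))                                ≡⟨ cong (a *_) triangular ⟩
      a * (k * k + k)                                            ∎
      where
      open ≡-Reasoning
      rows-split : ∀ t r → suc (3 * t + r) ≡ suc (2 * t + r) + t
      rows-split = solve-∀
      swap : ∀ a s → 2 * (a * s) ≡ a * (2 * s)
      swap = solve-∀
      vanishing : ∑ℕ t (λ j → lo (suc k + j)) ≡ 0
      vanishing = trans (∑ℕ-cong t (λ j _ → trans (cong (a *_) (ℕP.m≤n⇒m∸n≡0 (ℕP.≤-trans (ℕP.n≤1+n k) (ℕP.m≤m+n (suc k) j))))
                                                  (ℕP.*-zeroʳ a)))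
                        (∑ℕ-zeros t)
      triangular : 2 * ∑ℕ (suc k) (k ∸_) ≡ k * k + k
      triangular = ℕP.+-cancelʳ-≡ (1 * (suc k * suc k)) _ _ (trans
        (cong (λ s → 2 * s + 1 * (suc k * suc k)) (∑ℕ-cong (suc k) (λ y _ → cong (k ∸_) (sym (ℕP.*-identityˡ y)))))
        (trans (∑ℕ-descending (suc k) k 1 (λ y y<1+k → subst (_≤ k) (sym (ℕP.*-identityˡ y)) (ℕP.≤-pred y<1+k)))
               (square k)))
        where
        square : ∀ k → suc k * (2 * k) + 1 * suc k ≡ k * k + k + 1 * (suc k * suc k)
        square = solve-∀

    2∑hi-lower : 2 * ∑ℕ (suc t) (suc ∘ hi) + 4 * (suc t * suc t) ≡ suc t * (2 * suc P′) + 4 * suc t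
    2∑hi-lower = trans (cong (λ s → 2 * s + 4 * (suc t * suc t)) (∑ℕ-cong (suc t) row-length))
                       (∑ℕ-descending (suc t) (suc P′) 4 (λ y y<1+t → ℕP.m≤n⇒m≤1+n (4y≤P′ y (bound y y<1+t))))
      where
      bound : ∀ y → y < suc t → 2 * y ≤ 3 * k
      bound y y<1+t = ℕP.≤-trans (lower-row y y<1+t) (ℕP.m≤n*m k 3)
      row-length : ∀ y → y < suc t → suc (hi y) ≡ suc P′ ∸ 4 * y
      row-length y y<1+t = trans (cong suc (hi-lower y (lower-row y y<1+t)))
                                 (sym (ℕP.+-∸-assoc 1 (4y≤P′ y (bound y y<1+t))))

    2∑hi-upper : 2 * ∑ℕ k (λ j → suc (hi (suc t + j))) + (2 * e + 4) * (k * k) + 2 * k * ((2 * e + 4) * suc t)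
                 ≡ k * (2 * suc Q′) + (2 * e + 4) * k
    2∑hi-upper = begin
      2 * ∑ℕ k (λ j → suc (hi (suc t + j))) + c * (k * k) + 2 * k * B
        ≡⟨ cong (λ s → 2 * s + c * (k * k) + 2 * k * B) (∑ℕ-cong k row-length) ⟩
      2 * ∑ℕ k (λ j → C ∸ c * j) + c * (k * k) + 2 * k * B
        ≡⟨ cong (_+ 2 * k * B) (∑ℕ-descending k C c (λ j j<k → column-bound j j<k)) ⟩
      k * (2 * C) + c * k + 2 * k * B
        ≡⟨ regroup k C c B ⟩
      k * (2 * (C + B)) + c * k
        ≡⟨ cong (λ s → k * (2 * s) + c * k) (ℕP.m∸n+n≡m B≤1+Q′) ⟩
      k * (2 * suc Q′) + c * k ∎
      where
      open ≡-Reasoning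
      c B C : ℕ
      c = 2 * e + 4
      B = c * suc t
      C = suc Q′ ∸ B
      row-fits : ∀ j → j < k → c * (suc t + j) ≤ Q′
      row-fits j j<k = Equivalence.from (top-coefficient⇔ (suc t + j)) (proj₂ (upper-row j j<k))
      row-split : ∀ j → c * (suc t + j) ≡ B + c * j
      row-split j = ℕP.*-distribˡ-+ c (suc t) j
      column-bound : ∀ j → j < k → c * j ≤ C
      column-bound j j<k = ℕP.m+n≤o⇒m≤o∸n (c * j)
        (subst (_≤ suc Q′) (trans (row-split j) (ℕP.+-comm B (c * j))) (ℕP.m≤n⇒m≤1+n (row-fits j j<k)))
      B≤1+Q′ : B ≤ suc Q′
      B≤1+Q′ = ℕP.m≤n⇒m≤1+n (subst (λ n → c * n ≤ Q′) (ℕP.+-identityʳ (suc t)) (row-fits 0 (ℕ.>-nonZero⁻¹ k)))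
      row-length : ∀ j → j < k → suc (hi (suc t + j)) ≡ C ∸ c * j
      row-length j j<k = begin
        suc (hi (suc t + j))                ≡⟨ cong suc (hi-upper (suc t + j) (proj₁ (upper-row j j<k)) (proj₂ (upper-row j j<k))) ⟩
        suc (Q′ ∸ c * (suc t + j))          ≡⟨ sym (ℕP.+-∸-assoc 1 (row-fits j j<k)) ⟩
        suc Q′ ∸ c * (suc t + j)            ≡⟨ cong (suc Q′ ∸_) (row-split j) ⟩
        suc Q′ ∸ (B + c * j)                ≡⟨ sym (ℕP.∸-+-assoc (suc Q′) B (c * j)) ⟩
        C ∸ c * j                           ∎
      regroup : ∀ k C c B → k * (2 * C) + c * k + 2 * k * B ≡ k * (2 * (C + B)) + c * k
      regroup = solve-∀

    lattice-count : 2 * ∑ℕ (suc Y) len + a * (k * k + k) ≡ (4 * e + 9) * (k * k) + (2 * e + 9) * k + 2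
    lattice-count = ℕP.+-cancelʳ-≡ X _ _ (begin
      2 * L + a * (k * k + k) + X                               ≡⟨ cong (λ s → 2 * L + s + X) (sym 2∑lo) ⟩
      2 * L + 2 * Slo + X                                       ≡⟨ cong (_+ X) (sym (ℕP.*-distribˡ-+ 2 L Slo)) ⟩
      2 * (L + Slo) + X                                         ≡⟨ cong (λ s → 2 * s + X) rows-total ⟩
      2 * (Sl + Su) + X                                         ≡⟨ regroup Sl Su _ _ _ ⟩
      (2 * Sl + 4 * (suc t * suc t))
        + (2 * Su + (2 * e + 4) * (k * k) + 2 * k * ((2 * e + 4) * suc t))
                                                                ≡⟨ cong₂ _+_ 2∑hi-lower 2∑hi-upper ⟩
      (suc t * (2 * suc P′) + 4 * suc t) + (k * (2 * suc Q′) + (2 * e + 4) * k)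
                                                                ≡⟨ ℕP.+-cancelʳ-≡ r _ _ polynomial ⟩
      (4 * e + 9) * (k * k) + (2 * e + 9) * k + 2 + X           ∎)
      where
      open ≡-Reasoning
      L Slo Sl Su X : ℕ
      L   = ∑ℕ (suc Y) len
      Slo = ∑ℕ (suc Y) lo
      Sl  = ∑ℕ (suc t) (suc ∘ hi)
      Su  = ∑ℕ k (λ j → suc (hi (suc t + j)))
      X   = 4 * (suc t * suc t) + (2 * e + 4) * (k * k) + 2 * k * ((2 * e + 4) * suc t)
      rows-total : L + Slo ≡ Sl + Su
      rows-total = trans (∑ℕ-∸ (suc Y) (suc ∘ hi) lo
                           (λ y y<1+Y → ℕP.m≤n⇒m≤1+n (lo≤hi y (Equivalence.from (rows⇔ y) (ℕP.≤-pred y<1+Y)))))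
                         (trans (cong (λ n → ∑ℕ n (suc ∘ hi)) (rows-split t r)) (∑ℕ-split (suc t) k (suc ∘ hi)))
        where
        rows-split : ∀ t r → suc (3 * t + r) ≡ suc t + (2 * t + r)
        rows-split = solve-∀
      regroup : ∀ Sl Su X₁ X₂ X₃ → 2 * (Sl + Su) + (X₁ + X₂ + X₃) ≡ (2 * Sl + X₁) + (2 * Su + X₂ + X₃)
      regroup = solve-∀
      -- The count identity made polynomial by adding r * r on the left and r on the right (equal as r ≤ 1).
      identity : ∀ e t r →
        (suc t * (2 * suc ((2 * e + 6) * (2 * t + r))) + 4 * suc t)
          + ((2 * t + r) * (2 * suc ((3 * e + 6) * (2 * t + r))) + (2 * e + 4) * (2 * t + r)) + r * r
        ≡ (4 * e + 9) * ((2 * t + r) * (2 * t + r)) + (2 * e + 9) * (2 * t + r) + 2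
          + (4 * (suc t * suc t) + (2 * e + 4) * ((2 * t + r) * (2 * t + r)) + 2 * (2 * t + r) * ((2 * e + 4) * suc t)) + r
      identity = solve-∀
      polynomial : (suc t * (2 * suc P′) + 4 * suc t) + (k * (2 * suc Q′) + (2 * e + 4) * k) + r
                   ≡ (4 * e + 9) * (k * k) + (2 * e + 9) * k + 2 + X + r
      polynomial = trans (cong ((suc t * (2 * suc P′) + 4 * suc t) + (k * (2 * suc Q′) + (2 * e + 4) * k) +_) (sym (bit² r≤1)))
                         (identity e t r)

-- Lattice points of P

module _ where
  open ℕ using (ℕ; zero; suc; _+_; _*_; _∸_; _≤_; _<_; z≤n; s≤s)
  open ℤ using (ℤ)
  open ℚ using (0ℚ; 1ℚ)

  module LatticePointsOfP (e a d : ℕ) (a+d≡ : a + d ≡ 2 * e + 6) where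
    open Polygon e a d a+d≡
    open InDilate
    open LatticePoints e a d a+d≡
    open Counting e a d a+d≡ 1 using (a≤2e+6)

    ∈P⇔lattice : ∀ z → ℤ²→Pt z ∈conv V ⇔ LatticePoint 1 z
    ∈P⇔lattice z = mk⇔ (Equivalence.to (lattice-points⇔ 1 z) ∘ Equivalence.to (∈conv⇔∈dil₁ V (ℤ²→Pt z)))
                       (Equivalence.from (∈conv⇔∈dil₁ V (ℤ²→Pt z)) ∘ Equivalence.from (lattice-points⇔ 1 z))

    two-rows : ∀ {x y} → InDilate 1 x y → (y ≡ 0 × a ≤ x × x ≤ 2 * e + 6) ⊎ (y ≡ 1 × x ≤ 2 + e)
    two-rows {x} {zero} in-P =
      inj₁ (refl , subst₂ _≤_ (ℕP.*-identityʳ a) (bottom-x x a) (above-slant in-P) ,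
                   subst₂ _≤_ (bottom-x x 4) (ℕP.*-identityʳ _) (below-right in-P))
      where
      bottom-x : ∀ x c → x + c * 0 ≡ x
      bottom-x = solve-∀
    two-rows {x} {suc zero} in-P =
      inj₂ (refl , ℕP.+-cancelʳ-≤ (2 * e + 4) x (2 + e)
                     (subst₂ _≤_ (cong (x +_) (ℕP.*-identityʳ _)) (split e) (below-top in-P)))
      where
      split : ∀ e → (3 * e + 6) * 1 ≡ 2 + e + (2 * e + 4)
      split = solve-∀
    two-rows {x} {suc (suc y)} in-P = ⊥-elim (ℕP.<⇒≱ (ℕP.≤-trans too-high (ℕP.m≤n+m _ x)) (below-top in-P))
      where
      too-high : (3 * e + 6) * 1 < (2 * e + 4) * (2 + y)
      too-high = ≤-offset (e + 2 * e * y + 4 * y + 1) (identity e y)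
        where
        identity : ∀ e y → suc ((3 * e + 6) * 1) + (e + 2 * e * y + 4 * y + 1) ≡ (2 * e + 4) * (2 + y)
        identity = solve-∀

    row-cases : ∀ {x} → x ≤ 2 + e → x ≡ 0 ⊎ x ≡ 2 + e ⊎ ∃ λ j → j < suc e × x ≡ 1 + j
    row-cases {zero}  _         = inj₁ refl
    row-cases {suc j} (s≤s j≤1+e) with ℕP.m≤n⇒m<n∨m≡n j≤1+e
    ... | inj₁ j<1+e = inj₂ (inj₂ (j , j<1+e , refl))
    ... | inj₂ refl  = inj₂ (inj₁ refl)

    interior-point : ∀ j → j < suc e → Interior V (ℤ²→Pt (ℤ.+ (1 + j) , ℤ.+ 1))
    interior-point j (s≤s j≤e) = strict⇒interior (7 + 2 * e) weights stricts
      where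
      weights : All (λ h → weight h ≤ 7 + 2 * e) facets
      weights = s≤s z≤n ∷ s≤s z≤n ∷ s≤s (subst (a ≤_) (ℕP.+-comm (2 * e) 6) a≤2e+6)
              ∷ s≤s (s≤s (s≤s (s≤s (s≤s z≤n)))) ∷ ≤-offset 2 (top-weight e) ∷ []
        where
        top-weight : ∀ e → (1 + (2 * e + 4)) + (0 + 0) + 2 ≡ 7 + 2 * e
        top-weight = solve-∀
      stricts : All (λ h → Strict h (1 + j , 1)) facets
      stricts = s≤s z≤n ∷ s≤s z≤n
              ∷ subst (a * 1 <_) (sym (⟦x+cy⟧ℕ a (1 + j) 1 1)) (s≤s (ℕP.m≤n+m (a * 1) j))
              ∷ subst (λ n → suc n ≤ (2 * e + 6) * 1) (sym (⟦x+cy⟧ℕ 4 (1 + j) 1 1))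
                      (ℕP.≤-trans (s≤s (ℕP.+-monoˡ-≤ (4 * 1) (s≤s j≤e))) (≤-offset e (right-gap e)))
              ∷ subst (λ n → suc n ≤ (3 * e + 6) * 1) (sym (⟦x+cy⟧ℕ (2 * e + 4) (1 + j) 1 1))
                      (ℕP.≤-trans (s≤s (ℕP.+-monoˡ-≤ ((2 * e + 4) * 1) (s≤s j≤e))) (ℕP.≤-reflexive (top-gap e)))
              ∷ []
        where
        right-gap : ∀ e → suc (1 + e + 4 * 1) + e ≡ (2 * e + 6) * 1
        right-gap = solve-∀
        top-gap : ∀ e → suc (1 + e + (2 * e + 4) * 1) ≡ (3 * e + 6) * 1
        top-gap = solve-∀


    bottom-not-interior : ∀ x → ¬ Interior V (ℤ²→Pt (ℤ.+ x , ℤ.+ 0))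
    bottom-not-interior x =
      tight⇒¬interior bottom {V} {x} {0} (All.head ∘ All.tail ∘ sound) refl 0ℚ (ℚ.- 1ℚ)
        (ℚP.<⇒≤ (ℚP.positive⁻¹ 1ℚ)) ℚP.≤-refl (ℚP.negative⁻¹ (ℚ.- 1ℚ))

    left-not-interior : ¬ Interior V (ℤ²→Pt (ℤ.+ 0 , ℤ.+ 1))
    left-not-interior =
      tight⇒¬interior left {V} {0} {1} (All.head ∘ sound) refl (ℚ.- 1ℚ) 0ℚ
        ℚP.≤-refl (ℚP.<⇒≤ (ℚP.positive⁻¹ 1ℚ)) (ℚP.negative⁻¹ (ℚ.- 1ℚ))

    right-not-interior : ¬ Interior V (ℤ²→Pt (ℤ.+ (2 + e) , ℤ.+ 1))
    right-not-interior =
      tight⇒¬interior top {V} {2 + e} {1} (All.head ∘ All.tail ∘ All.tail ∘ All.tail ∘ All.tail ∘ sound) (tight e) 1ℚ 0ℚ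
        ℚP.≤-refl (ℚP.<⇒≤ (ℚP.positive⁻¹ 1ℚ))
        (subst (0ℚ ℚ.<_) (sym (unit-slope (ℕ→ℚ (2 * e + 4)))) (ℚP.positive⁻¹ 1ℚ))
      where
      tight : ∀ e → 1 * (2 + e) + (2 * e + 4) * 1 + 0 * 1 ≡ 0 * (2 + e) + 0 * 1 + (3 * e + 6) * 1
      tight = solve-∀
      unit-slope : ∀ c → ℕ→ℚ 1 ℚ.* 1ℚ ℚ.+ c ℚ.* 0ℚ ≡ 1ℚ
      unit-slope = ring-solve-∀ ℚ-ring

    interior⇒segment : ∀ z → Interior V (ℤ²→Pt z) → Segment 1 1 (suc e) z
    interior⇒segment z interior = from-lattice interior (Equivalence.to (∈P⇔lattice z) (interior⇒∈conv {V} interior))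
      where
      on-row₁ : ∀ {x} → Interior V (ℤ²→Pt (ℤ.+ x , ℤ.+ 1)) →
                x ≡ 0 ⊎ x ≡ 2 + e ⊎ (∃ λ j → j < suc e × x ≡ 1 + j) → Segment 1 1 (suc e) (ℤ.+ x , ℤ.+ 1)
      on-row₁ interior (inj₁ refl)                      = ⊥-elim (left-not-interior interior)
      on-row₁ interior (inj₂ (inj₁ refl))               = ⊥-elim (right-not-interior interior)
      on-row₁ interior (inj₂ (inj₂ (j , j<1+e , refl))) = j , j<1+e , refl
      classify : ∀ {x y} → Interior V (ℤ²→Pt (ℤ.+ x , ℤ.+ y)) →
                 (y ≡ 0 × a ≤ x × x ≤ 2 * e + 6) ⊎ (y ≡ 1 × x ≤ 2 + e) → Segment 1 1 (suc e) (ℤ.+ x , ℤ.+ y)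
      classify {x} interior (inj₁ (refl , _))     = ⊥-elim (bottom-not-interior x interior)
      classify     interior (inj₂ (refl , x≤2+e)) = on-row₁ interior (row-cases x≤2+e)
      from-lattice : ∀ {z} → Interior V (ℤ²→Pt z) → LatticePoint 1 z → Segment 1 1 (suc e) z
      from-lattice interior (x , y , refl , in-P) = classify interior (two-rows in-P)

    interior-count : HasCard (λ z → Interior V (ℤ²→Pt z)) (suc e)
    interior-count = HasCard-cong (λ { _ (j , j<1+e , refl) → interior-point j j<1+e }) interior⇒segment
                                  (HasCard-segment 1 1 (suc e))

    left-in-P : InDilate 1 0 1
    left-in-P = record
      { above-slant = ℕP.≤-refl
      ; below-right = ≤-offset (2 * e + 2) (right-gap e)
      ; below-top   = ≤-offset (e + 2) (top-gap e)
      }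
      where
      right-gap : ∀ e → 4 * 1 + (2 * e + 2) ≡ (2 * e + 6) * 1
      right-gap = solve-∀
      top-gap : ∀ e → (2 * e + 4) * 1 + (e + 2) ≡ (3 * e + 6) * 1
      top-gap = solve-∀

    right-in-P : InDilate 1 (2 + e) 1
    right-in-P = record
      { above-slant = ℕP.m≤n+m (a * 1) (2 + e)
      ; below-right = ≤-offset e (right-gap e)
      ; below-top   = ℕP.≤-reflexive (top-gap e)
      }
      where
      right-gap : ∀ e → 2 + e + 4 * 1 + e ≡ (2 * e + 6) * 1
      right-gap = solve-∀
      top-gap : ∀ e → 2 + e + (2 * e + 4) * 1 ≡ (3 * e + 6) * 1
      top-gap = solve-∀

    bottom-in-P : ∀ j → j ≤ d → InDilate 1 (a + j) 0
    bottom-in-P j j≤d = record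
      { above-slant = ≤-offset j (slant-gap a j)
      ; below-right = subst₂ _≤_ (sym (on-axis (a + j) 4)) (trans a+d≡ (sym (ℕP.*-identityʳ _))) (ℕP.+-monoʳ-≤ a j≤d)
      ; below-top   = subst₂ _≤_ (sym (on-axis (a + j) (2 * e + 4))) (trans (cong (_+ e) a+d≡) (widen e))
                             (ℕP.≤-trans (ℕP.+-monoʳ-≤ a j≤d) (ℕP.m≤m+n (a + d) e))
      }
      where
      slant-gap : ∀ a j → a * 1 + j ≡ a + j + a * 0
      slant-gap = solve-∀
      on-axis : ∀ x c → x + c * 0 ≡ x
      on-axis = solve-∀
      widen : ∀ e → 2 * e + 6 + e ≡ (3 * e + 6) * 1
      widen = solve-∀

    BoundaryPoint : ℤ × ℤ → Set
    BoundaryPoint z = z ≡ (ℤ.+ 0 , ℤ.+ 1) ⊎ z ≡ (ℤ.+ (2 + e) , ℤ.+ 1) ⊎ Segment 0 a (suc d) z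

    lattice-point∈P : ∀ x y → InDilate 1 x y → ℤ²→Pt (ℤ.+ x , ℤ.+ y) ∈conv V
    lattice-point∈P x y in-P = Equivalence.from (∈P⇔lattice (ℤ.+ x , ℤ.+ y)) (x , y , refl , in-P)

    BoundaryPoint⇒boundary : ∀ z → BoundaryPoint z → Boundary V (ℤ²→Pt z)
    BoundaryPoint⇒boundary _ (inj₁ refl)        = lattice-point∈P 0 1 left-in-P , left-not-interior
    BoundaryPoint⇒boundary _ (inj₂ (inj₁ refl)) = lattice-point∈P (2 + e) 1 right-in-P , right-not-interior
    BoundaryPoint⇒boundary _ (inj₂ (inj₂ (j , j<1+d , refl))) =
      lattice-point∈P (a + j) 0 (bottom-in-P j (ℕP.≤-pred j<1+d)) , bottom-not-interior (a + j)

    boundary⇒BoundaryPoint : ∀ z → Boundary V (ℤ²→Pt z) → BoundaryPoint z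
    boundary⇒BoundaryPoint z (z∈ , not-interior) = from-lattice not-interior (Equivalence.to (∈P⇔lattice z) z∈)
      where
      on-row₁ : ∀ {x} → ¬ Interior V (ℤ²→Pt (ℤ.+ x , ℤ.+ 1)) →
                x ≡ 0 ⊎ x ≡ 2 + e ⊎ (∃ λ j → j < suc e × x ≡ 1 + j) → BoundaryPoint (ℤ.+ x , ℤ.+ 1)
      on-row₁ _            (inj₁ refl)                      = inj₁ refl
      on-row₁ _            (inj₂ (inj₁ refl))               = inj₂ (inj₁ refl)
      on-row₁ not-interior (inj₂ (inj₂ (j , j<1+e , refl))) = ⊥-elim (not-interior (interior-point j j<1+e))
      classify : ∀ {x y} → ¬ Interior V (ℤ²→Pt (ℤ.+ x , ℤ.+ y)) →
                 (y ≡ 0 × a ≤ x × x ≤ 2 * e + 6) ⊎ (y ≡ 1 × x ≤ 2 + e) → BoundaryPoint (ℤ.+ x , ℤ.+ y)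
      classify {x} _ (inj₁ (refl , a≤x , x≤2e+6)) =
        inj₂ (inj₂ (x ∸ a , s≤s (ℕP.m≤n+o⇒m∸n≤o x a (subst (x ≤_) (sym a+d≡) x≤2e+6)) ,
                    cong (λ u → ℤ.+ u , ℤ.+ 0) (sym (ℕP.m+[n∸m]≡n a≤x))))
      classify not-interior (inj₂ (refl , x≤2+e)) = on-row₁ not-interior (row-cases x≤2+e)
      from-lattice : ∀ {z} → ¬ Interior V (ℤ²→Pt z) → LatticePoint 1 z → BoundaryPoint z
      from-lattice not-interior (x , y , refl , in-P) = classify not-interior (two-rows in-P)

    boundary-count : HasCard (λ z → Boundary V (ℤ²→Pt z)) (3 + d)
    boundary-count = HasCard-cong BoundaryPoint⇒boundary boundary⇒BoundaryPoint
      (HasCard-⊎ (λ { _ refl (inj₁ ()) ; _ refl (inj₂ (_ , _ , ())) })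
        (HasCard-singleton (ℤ.+ 0 , ℤ.+ 1))
        (HasCard-⊎ (λ { _ refl (_ , _ , ()) }) (HasCard-singleton (ℤ.+ (2 + e) , ℤ.+ 1)) (HasCard-segment 0 a (suc d))))

-- The denominator

module _ where
  open ℕ using (ℕ; zero; suc; z≤n; s≤s)
  open ℚ using (ℚ; 0ℚ; 1ℚ; _/_; _+_; _*_; _<_)

  module Denominator (e a d : ℕ) (a+d≡ : a ℕ.+ d ≡ 2 ℕ.* e ℕ.+ 6) where
    open Polygon e a d a+d≡
    open Triangulation e a d a+d≡ using (E)

    v₀ : Pt
    v₀ = 0ℚ , ℤ.+ 3 / 2

    top-at-v₀ : ℕ→ℚ (2 ℕ.* e ℕ.+ 4) * (ℤ.+ 3 / 2) ≡ ℕ→ℚ (3 ℕ.* e ℕ.+ 6)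
    top-at-v₀ = trans (cong (_* (ℤ.+ 3 / 2)) (ℕ→ℚ-affine 2 e 4))
                      (trans (three-halves E) (sym (ℕ→ℚ-affine 3 e 6)))
      where
      three-halves : ∀ E → (ℕ→ℚ 2 * E + ℕ→ℚ 4) * (ℤ.+ 3 / 2) ≡ ℕ→ℚ 3 * E + ℕ→ℚ 6
      three-halves = ring-solve-∀ ℚ-ring

    on-left-and-top⇒v₀ : ∀ {p} → OnLine left p → OnLine top p → p ≡ v₀
    on-left-and-top⇒v₀ {x , y} on-left on-top = cong₂ _,_ x≡0 y≡3/2
      where
      x≡0 : x ≡ 0ℚ
      x≡0 = trans (sym (left-form x y)) (trans (sym on-left) (origin-form x y))
        where
        left-form : ∀ x y → ℕ→ℚ 1 * x + ℕ→ℚ 0 * y + ℕ→ℚ 0 * 1ℚ ≡ x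
        left-form = ring-solve-∀ ℚ-ring
        origin-form : ∀ x y → ℕ→ℚ 0 * x + ℕ→ℚ 0 * y + ℕ→ℚ 0 * 1ℚ ≡ 0ℚ
        origin-form = ring-solve-∀ ℚ-ring
      y≡3/2 : y ≡ ℤ.+ 3 / 2
      y≡3/2 = pos-*-cancelˡ (ℚP.<-≤-trans (ℕ→ℚ-pos 4) (ℕ→ℚ-mono-≤ {4} {2 ℕ.* e ℕ.+ 4} (ℕP.m≤n+m 4 (2 ℕ.* e)))) (begin
        C₂ * y                                                     ≡⟨ sym (top-lhs C₂ x y x≡0) ⟩
        ℕ→ℚ 1 * x + C₂ * y + ℕ→ℚ 0 * 1ℚ                            ≡⟨ on-top ⟩
        ℕ→ℚ 0 * x + ℕ→ℚ 0 * y + C₃ * 1ℚ                            ≡⟨ top-rhs C₃ x y ⟩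
        C₃                                                         ≡⟨ sym top-at-v₀ ⟩
        C₂ * (ℤ.+ 3 / 2)                                           ∎)
        where
        open ≡-Reasoning
        C₂ C₃ : ℚ
        C₂ = ℕ→ℚ (2 ℕ.* e ℕ.+ 4)
        C₃ = ℕ→ℚ (3 ℕ.* e ℕ.+ 6)
        on-axis : ∀ C y → ℕ→ℚ 1 * 0ℚ + C * y + ℕ→ℚ 0 * 1ℚ ≡ C * y
        on-axis = ring-solve-∀ ℚ-ring
        top-lhs : ∀ C x y → x ≡ 0ℚ → ℕ→ℚ 1 * x + C * y + ℕ→ℚ 0 * 1ℚ ≡ C * y
        top-lhs C x y refl = on-axis C y
        top-rhs : ∀ C x y → ℕ→ℚ 0 * x + ℕ→ℚ 0 * y + C * 1ℚ ≡ C
        top-rhs = ring-solve-∀ ℚ-ring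

    v₀-vertex : IsVertex V v₀
    v₀-vertex = head∈conv 4 (pts V) , extreme
      where
      left∋ : ∀ {p} → p ∈conv V → left ∋ p
      left∋ = All.head ∘ sound
      top∋ : ∀ {p} → p ∈conv V → top ∋ p
      top∋  = All.head ∘ All.tail ∘ All.tail ∘ All.tail ∘ All.tail ∘ sound
      on-top-v₀ : OnLine top v₀
      on-top-v₀ = trans (at-v₀ (ℕ→ℚ (2 ℕ.* e ℕ.+ 4))) (trans top-at-v₀ (sym (constant (ℕ→ℚ (3 ℕ.* e ℕ.+ 6)))))
        where
        at-v₀ : ∀ C → ℕ→ℚ 1 * 0ℚ + C * (ℤ.+ 3 / 2) + ℕ→ℚ 0 * 1ℚ ≡ C * (ℤ.+ 3 / 2)
        at-v₀ = ring-solve-∀ ℚ-ring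
        constant : ∀ C → ℕ→ℚ 0 * 0ℚ + ℕ→ℚ 0 * (ℤ.+ 3 / 2) + C * 1ℚ ≡ C
        constant = ring-solve-∀ ℚ-ring
      extreme : ∀ p q t → p ∈conv V → q ∈conv V → 0ℚ < t → t < 1ℚ →
                v₀ ≡ mix t p q → p ≡ q
      extreme p q t p∈ q∈ 0<t t<1 v₀≡ = trans (on-left-and-top⇒v₀ (proj₁ left-split) (proj₁ top-split))
                                         (sym (on-left-and-top⇒v₀ (proj₂ left-split) (proj₂ top-split)))
        where
        left-split : OnLine left p × OnLine left q
        left-split = onLine-split left t (left∋ p∈) (left∋ q∈) 0<t t<1 (subst (OnLine left) v₀≡ refl)
        top-split : OnLine top p × OnLine top q
        top-split = onLine-split top t (top∋ p∈) (top∋ q∈) 0<t t<1 (subst (OnLine top) v₀≡ on-top-v₀)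

    v₀-not-integral : ¬ IsLatticePt (ℕ→ℚ 1 · v₀)
    v₀-not-integral ((zx , zy) , z≡v₀) = one≢two (cong ℚ.denominatorℕ (trans (sym (ℤ→ℚ≡fromℤ zy)) (cong proj₂ z≡v₀)))
      where
      one≢two : ¬ 1 ≡ 2
      one≢two ()

    denominator : HasDenominator V 2
    denominator = s≤s z≤n , integral , minimal
      where
      integral : IntegralDilate V 2
      integral v v-vertex = lattice (vertex⇒generator 5 (pts V) v-vertex)
        where
        lattice : (∃ λ j → v ≡ pts V j) → IsLatticePt (ℕ→ℚ 2 · v)
        lattice (j , refl) = (ℤ.+ proj₁ (doubled j) , ℤ.+ proj₂ (doubled j)) , sym (twice-vertex j)
      minimal : ∀ d′ → 1 ℕ.≤ d′ → IntegralDilate V d′ → 2 ℕ.≤ d′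
      minimal (suc zero)    _ integral₁ = ⊥-elim (v₀-not-integral (integral₁ v₀ v₀-vertex))
      minimal (suc (suc _)) _ _         = s≤s (s≤s z≤n)

-- The Ehrhart polynomial

module _ where
  open ℕ using (ℕ; suc; NonZero)
  open Data.Nat.DivMod using (_/_; _%_; m≡m%n+[m/n]*n; m%n<n)
  open ℚ using (ℚ; 0ℚ; 1ℚ; ½; _+_; _*_; _-_)

  module Ehrhart (e a d : ℕ) (a+d≡ : a ℕ.+ d ≡ 2 ℕ.* e ℕ.+ 6) where
    open Polygon e a d a+d≡

    E A D I B : ℚ
    E = ℕ→ℚ e
    A = ℕ→ℚ a
    D = ℕ→ℚ d
    I = ℕ→ℚ (suc e)
    B = ℕ→ℚ (3 ℕ.+ d)

    ehrhart-coefficients : List ℚ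
    ehrhart-coefficients = 1ℚ ∷ B * ½ ∷ I + B * ½ - 1ℚ ∷ []

    count⇒polynomial : ∀ k L →
      2 ℕ.* L ℕ.+ a ℕ.* (k ℕ.* k ℕ.+ k) ≡ (4 ℕ.* e ℕ.+ 9) ℕ.* (k ℕ.* k) ℕ.+ (2 ℕ.* e ℕ.+ 9) ℕ.* k ℕ.+ 2 →
      ℕ→ℚ L ≡ evalPoly ehrhart-coefficients (ℕ→ℚ k)
    count⇒polynomial k L count = begin
      ℕ→ℚ L                                                         ≡⟨ halve (ℕ→ℚ L) A K ⟩
      ½ * (ℕ→ℚ 2 * ℕ→ℚ L + A * (K * K + K)) - ½ * A * (K * K + K)   ≡⟨ cong (λ s → ½ * s - ½ * A * (K * K + K)) cast-count ⟩
      ½ * ((ℕ→ℚ 4 * E + ℕ→ℚ 9) * (K * K) + (ℕ→ℚ 2 * E + ℕ→ℚ 9) * K + ℕ→ℚ 2) - ½ * A * (K * K + K)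
                                                                    ≡⟨ cong (λ s → ½ * ((ℕ→ℚ 4 * E + ℕ→ℚ 9) * (K * K) + (ℕ→ℚ 2 * E + ℕ→ℚ 9) * K + ℕ→ℚ 2) - ½ * s * (K * K + K)) A≡ ⟩
      ½ * ((ℕ→ℚ 4 * E + ℕ→ℚ 9) * (K * K) + (ℕ→ℚ 2 * E + ℕ→ℚ 9) * K + ℕ→ℚ 2) - ½ * (ℕ→ℚ 2 * E + ℕ→ℚ 6 - D) * (K * K + K)
                                                                    ≡⟨ collect E D K ⟩
      1ℚ + K * ((ℕ→ℚ 3 + D) * ½ + K * ((ℕ→ℚ 1 + E) + (ℕ→ℚ 3 + D) * ½ - 1ℚ + K * 0ℚ))
                                                                    ≡⟨ cong₂ (λ i b → 1ℚ + K * (b * ½ + K * (i + b * ½ - 1ℚ + K * 0ℚ)))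
                                                                             (sym (ℕ→ℚ-+ 1 e)) (sym (ℕ→ℚ-+ 3 d)) ⟩
      evalPoly ehrhart-coefficients K                               ∎
      where
      open ≡-Reasoning
      K : ℚ
      K = ℕ→ℚ k
      halve : ∀ L A K → L ≡ ½ * (ℕ→ℚ 2 * L + A * (K * K + K)) - ½ * A * (K * K + K)
      halve = ring-solve-∀ ℚ-ring
      collect : ∀ E D K → ½ * ((ℕ→ℚ 4 * E + ℕ→ℚ 9) * (K * K) + (ℕ→ℚ 2 * E + ℕ→ℚ 9) * K + ℕ→ℚ 2)
                            - ½ * (ℕ→ℚ 2 * E + ℕ→ℚ 6 - D) * (K * K + K)
                          ≡ 1ℚ + K * ((ℕ→ℚ 3 + D) * ½ + K * ((ℕ→ℚ 1 + E) + (ℕ→ℚ 3 + D) * ½ - 1ℚ + K * 0ℚ))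
      collect = ring-solve-∀ ℚ-ring
      A≡ : A ≡ ℕ→ℚ 2 * E + ℕ→ℚ 6 - D
      A≡ = trans (add-sub A D) (cong (_- D) (trans (sym (ℕ→ℚ-+ a d)) (trans (cong ℕ→ℚ a+d≡) (ℕ→ℚ-affine 2 e 6))))
        where
        add-sub : ∀ A D → A ≡ A + D - D
        add-sub = ring-solve-∀ ℚ-ring
      cast-count : ℕ→ℚ 2 * ℕ→ℚ L + A * (K * K + K) ≡ (ℕ→ℚ 4 * E + ℕ→ℚ 9) * (K * K) + (ℕ→ℚ 2 * E + ℕ→ℚ 9) * K + ℕ→ℚ 2
      cast-count = trans (sym lhs-cast) (trans (cong ℕ→ℚ count) rhs-cast)
        where
        lhs-cast : ℕ→ℚ (2 ℕ.* L ℕ.+ a ℕ.* (k ℕ.* k ℕ.+ k)) ≡ ℕ→ℚ 2 * ℕ→ℚ L + A * (K * K + K)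
        lhs-cast = trans (ℕ→ℚ-+ (2 ℕ.* L) (a ℕ.* (k ℕ.* k ℕ.+ k)))
          (cong₂ _+_ (ℕ→ℚ-* 2 L) (trans (ℕ→ℚ-* a (k ℕ.* k ℕ.+ k)) (cong (A *_) (trans (ℕ→ℚ-+ (k ℕ.* k) k) (cong (_+ K) (ℕ→ℚ-* k k))))))
        rhs-cast : ℕ→ℚ ((4 ℕ.* e ℕ.+ 9) ℕ.* (k ℕ.* k) ℕ.+ (2 ℕ.* e ℕ.+ 9) ℕ.* k ℕ.+ 2)
                   ≡ (ℕ→ℚ 4 * E + ℕ→ℚ 9) * (K * K) + (ℕ→ℚ 2 * E + ℕ→ℚ 9) * K + ℕ→ℚ 2
        rhs-cast = trans (ℕ→ℚ-+ ((4 ℕ.* e ℕ.+ 9) ℕ.* (k ℕ.* k) ℕ.+ (2 ℕ.* e ℕ.+ 9) ℕ.* k) 2)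
          (cong (_+ ℕ→ℚ 2) (trans (ℕ→ℚ-+ ((4 ℕ.* e ℕ.+ 9) ℕ.* (k ℕ.* k)) ((2 ℕ.* e ℕ.+ 9) ℕ.* k)) (cong₂ _+_
            (trans (ℕ→ℚ-* (4 ℕ.* e ℕ.+ 9) (k ℕ.* k)) (cong₂ _*_ (ℕ→ℚ-affine 4 e 9) (ℕ→ℚ-* k k)))
            (trans (ℕ→ℚ-* (2 ℕ.* e ℕ.+ 9) k) (cong (_* K) (ℕ→ℚ-affine 2 e 9))))))

    pseudo-integral : PseudoIntegral V
    pseudo-integral = ehrhart-coefficients , λ k 1≤k →
      subst Counted (halves k) (counted (k / 2) (k % 2) (ℕP.≤-pred (m%n<n k 2))
                                        {{ℕ.>-nonZero (subst (0 ℕ.<_) (sym (halves k)) 1≤k)}})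
      where
      Counted : ℕ → Set
      Counted k = Σ ℕ λ L → HasCard (λ z → ℤ²→Pt z ∈dil k · V) L × ℕ→ℚ L ≡ evalPoly ehrhart-coefficients (ℕ→ℚ k)
      counted : ∀ t r → r ℕ.≤ 1 → .{{_ : NonZero (2 ℕ.* t ℕ.+ r)}} → Counted (2 ℕ.* t ℕ.+ r)
      counted t r r≤1 = ∑ℕ (suc Y) len , HasCard-dilate , count⇒polynomial (2 ℕ.* t ℕ.+ r) (∑ℕ (suc Y) len) lattice-count
        where
        open LatticeCount e a d a+d≡ t r r≤1
        open Counting e a d a+d≡ (2 ℕ.* t ℕ.+ r) using (len)
      halves : ∀ k → 2 ℕ.* (k / 2) ℕ.+ k % 2 ≡ k
      halves k = trans (rearrange (k / 2) (k % 2)) (sym (m≡m%n+[m/n]*n k 2))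
        where
        rearrange : ∀ t r → 2 ℕ.* t ℕ.+ r ≡ r ℕ.+ t ℕ.* 2
        rearrange = solve-∀

module _ where
  open ℕ using (ℕ; suc; _≤_; _+_; _*_; z≤n; s≤s)

  proposition6p1 : (i b : ℕ) → 1 ≤ i → 3 ≤ b → b ≤ 2 * i + 7 →
      PseudoIntegral (P2 i b)
      × HasDenominator (P2 i b) 2
      × HasCard (λ z → Interior (P2 i b) (ℤ²→Pt z)) i
      × HasCard (λ z → Boundary (P2 i b) (ℤ²→Pt z)) b
  proposition6p1 (suc e) (suc (suc (suc d))) (s≤s z≤n) (s≤s (s≤s (s≤s z≤n))) b≤2i+7 =
    Ehrhart.pseudo-integral e a d a+d≡ ,
    Denominator.denominator e a d a+d≡ ,
    LatticePointsOfP.interior-count e a d a+d≡ ,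
    LatticePointsOfP.boundary-count e a d a+d≡
    where
    a : ℕ
    a = proj₁ (ℕP.m≤n⇒∃[o]m+o≡n b≤2i+7)
    a+d≡ : a + d ≡ 2 * e + 6
    a+d≡ = ℕP.+-cancelˡ-≡ 3 (a + d) (2 * e + 6)
             (trans (reorder a d) (trans (proj₂ (ℕP.m≤n⇒∃[o]m+o≡n b≤2i+7)) (unfold e)))
      where
      reorder : ∀ a d → 3 + (a + d) ≡ 3 + d + a
      reorder = solve-∀
      unfold : ∀ e → 2 * suc e + 7 ≡ 3 + (2 * e + 6)
      unfold = solve-∀
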